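{- For each positive integer $n$, let $\mathcal{G}_n$ be the set of isomorphism classes of abelian groups of order $2^n$ and $\mathcal{A}_n\subseteq\mathcal{G}_n$ the subset of those that are admissible $2$-groups. Then $$\lim_{n\to\infty}\frac{\sum_{i=1}^n|\mathcal{A}_i|}{\sum_{i=1}^n|\mathcal{G}_i|}=1.$$
   Context: A finite abelian $2$-group written as $$G=\prod_{i=1}^t \mathbb{Z}_{2^{2s_i}}^{u_i}\times\prod_{j=1}^w \mathbb{Z}_{2^{2r_j+1}}^{v_j}\times \mathbb{Z}_2^{v},$$ with $t,w,v\ge 0$, $u_i,v_j\ge1$, $1\le s_1<\dots<s_t$, $1\le r_1<\dots<r_w$, is called admissible if $2\left\lfloor \frac{\sum_{1\le i\le t,\ s_i\notin\{1,2\}} u_i}{2}\right\rfloor+\sum_{j=1}^w v_j\ge v$; the trivial group is regarded as admissible. ($\mathbb{Z}_m$ denotes the cyclic group of order $m$.) -}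

module Defs where

open import Data.Nat using (ℕ; zero; suc; _+_; _*_; _∸_; _⊓_; _≤ᵇ_; _/_)
open import Data.Bool using (Bool; true; false; _∧_; not; if_then_else_)
open import Data.List using (List; []; _∷_; [_]; map; concatMap; applyUpTo; filterᵇ; length)
open import Data.Integer using (+_)
import Data.Rational as ℚ
open ℚ using (ℚ; 0ℚ)

-- By the fundamental theorem of finite abelian groups, an abelian group of
-- order 2^n is, up to isomorphism, ∏ ℤ_{2^{e_k}} for a unique partition
-- (e_1 ≥ e_2 ≥ …) of n.  We represent an isomorphism class by this
-- partition, i.e. a non-increasing list of positive exponents summing to n.

-- pb f n m : all partitions of n (non-increasing lists of positive parts)
-- with all parts ≤ m; f is fuel, sufficient whenever f ≥ n.
pb : ℕ → ℕ → ℕ → List (List ℕ)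
pb f       zero    m = [ [] ]
pb zero    (suc n) m = []
pb (suc f) (suc n) m =
  concatMap (λ k → map (k ∷_) (pb f (suc n ∸ k) k)) (applyUpTo suc (m ⊓ suc n))

𝒢 : ℕ → List (List ℕ)
𝒢 n = pb n n n

isEven : ℕ → Bool
isEven zero = true
isEven (suc zero) = false
isEven (suc (suc n)) = isEven n

_==_ : ℕ → ℕ → Bool
zero == zero = true
zero == suc _ = false
suc _ == zero = false
suc m == suc n = m == n

-- count of cyclic factors ℤ_{2^{2s}} with s ∉ {1,2}  (Σ u_i over s_i ∉ {1,2})
uCount : List ℕ → ℕ
uCount [] = 0
uCount (e ∷ es) =
  (if isEven e ∧ not (e == 2) ∧ not (e == 4) then 1 else 0) + uCount es

-- count of cyclic factors ℤ_{2^{2r+1}} with r ≥ 1  (Σ v_j)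
wCount : List ℕ → ℕ
wCount [] = 0
wCount (e ∷ es) =
  (if not (isEven e) ∧ not (e == 1) then 1 else 0) + wCount es

vCount : List ℕ → ℕ
vCount [] = 0
vCount (e ∷ es) = (if e == 1 then 1 else 0) + vCount es

-- admissibility: 2⌊U/2⌋ + W ≥ V  (trivial group: 0 ≥ 0, admissible)
admissible : List ℕ → Bool
admissible λs = vCount λs ≤ᵇ (2 * (uCount λs / 2) + wCount λs)

𝒜 : ℕ → List (List ℕ)
𝒜 n = filterᵇ admissible (𝒢 n)

sumFrom1 : (ℕ → ℕ) → ℕ → ℕ
sumFrom1 f zero = 0
sumFrom1 f (suc n) = sumFrom1 f n + f (suc n)

-- ratio n = (Σ_{i=1}^n |𝒜_i|) / (Σ_{i=1}^n |𝒢_i|)   (set to 0 if the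
-- denominator is 0, which only happens for n = 0)
ratio : ℕ → ℚ
ratio n with sumFrom1 (λ i → length (𝒢 i)) n
... | zero  = 0ℚ
... | suc d = (+ sumFrom1 (λ i → length (𝒜 i)) n) ℚ./ suc d

-- An abelian group of order 2^n is a partition of n, and a non-admissible one has at least as many parts 1
-- as parts outside {1, 2, 4}.  Fix L and a threshold r.  If the parts ≤ L of such a partition have total
-- size below r, it has at most 2r parts, and there are at most (n+1)^(2r) such partitions of size at most n:
-- negligibly many against the superpolynomially many partitions of size at most n.  Otherwise, removing a
-- part 1 for each part k ≤ L outside {1, 2, 4} shows that there are at most as many of them as partitions in
-- which each such part k counts as k + 1.  Both kinds of partitions are counted by recursions through stride
-- sums, and comparing these shows that the padding costs a factor of about ∏ k/(k+1) = 15/(4(L+1)) once r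
-- is large.  So non-admissible groups eventually have density O(1/L).
module Submission where

open import Defs

module Partitions where
  open import Data.List using (List; []; _∷_; [_]; _++_; map; concat; concatMap; applyUpTo)
  open import Data.List.Properties using (map-cong-local; applyUpTo-∷ʳ; concatMap-++; ++-identityʳ)
  open import Data.List.Relation.Unary.All.Properties using (applyUpTo⁺₁)
  open import Data.Nat
  open import Data.Nat.Properties
  open import Relation.Binary.PropositionalEquality hiding ([_])
  open ≡-Reasoning

  parts : ℕ → ℕ → List (List ℕ)
  parts n m = pb n n m

  pb-fuel-irrelevant : ∀ f f′ n m → n ≤ f → n ≤ f′ → pb f n m ≡ pb f′ n m
  pb-fuel-irrelevant f       f′       zero    m _         _          = refl
  pb-fuel-irrelevant (suc f) (suc f′) (suc n) m (s≤s n≤f) (s≤s n≤f′) =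
    cong concat (map-cong-local (applyUpTo⁺₁ suc (m ⊓ suc n) λ {i} _ →
      cong (map (suc i ∷_)) (pb-fuel-irrelevant f f′ (n ∸ i) (suc i) (≤-trans (m∸n≤m n i) n≤f) (≤-trans (m∸n≤m n i) n≤f′))))

  parts-< : ∀ n m → n ≤ m → parts n (suc m) ≡ parts n m
  parts-< zero    m _         = refl
  parts-< (suc n) m n<m =
    cong (λ j → concatMap (λ k → map (k ∷_) (pb n (suc n ∸ k) k)) (applyUpTo suc j))
         (trans (m≥n⇒m⊓n≡n (m≤n⇒m≤1+n n<m)) (sym (m≥n⇒m⊓n≡n n<m)))

  parts-≥ : ∀ n m → suc m ≤ n → parts n (suc m) ≡ parts n m ++ map (suc m ∷_) (parts (n ∸ suc m) (suc m))
  parts-≥ (suc n) m (s≤s m≤n) = begin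
    concatMap g (applyUpTo suc (suc m ⊓ suc n))       ≡⟨ cong (λ k → concatMap g (applyUpTo suc k)) (m≤n⇒m⊓n≡m (s≤s m≤n)) ⟩
    concatMap g (applyUpTo suc (suc m))               ≡⟨ cong (concatMap g) (applyUpTo-∷ʳ suc m) ⟨
    concatMap g (applyUpTo suc m ++ [ suc m ])        ≡⟨ concatMap-++ g (applyUpTo suc m) [ suc m ] ⟩
    concatMap g (applyUpTo suc m) ++ (g (suc m) ++ []) ≡⟨ cong (concatMap g (applyUpTo suc m) ++_) (++-identityʳ (g (suc m))) ⟩
    concatMap g (applyUpTo suc m) ++ g (suc m)        ≡⟨ cong₂ (λ k ps → concatMap g (applyUpTo suc k) ++ map (suc m ∷_) ps)
                                                              (sym (m≤n⇒m⊓n≡m (m≤n⇒m≤1+n m≤n)))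
                                                              (pb-fuel-irrelevant n (n ∸ m) (n ∸ m) (suc m) (m∸n≤m n m) ≤-refl) ⟩
    parts (suc n) m ++ map (suc m ∷_) (parts (n ∸ m) (suc m)) ∎
    where
    g : ℕ → List (List ℕ)
    g k = map (k ∷_) (pb n (suc n ∸ k) k)

  parts-bound≥size : ∀ n m → n ≤ m → parts n m ≡ parts n n
  parts-bound≥size n m n≤m = go (≤⇒≤′ n≤m)
    where
    go : ∀ {m} → n ≤′ m → parts n m ≡ parts n n
    go ≤′-refl          = refl
    go (≤′-step n≤′m) = trans (parts-< n _ (≤′⇒≤ n≤′m)) (go n≤′m)

module Counting where
  open import Algebra.Properties.CommutativeSemigroup as CommSemigroupProperties using ()
  open import Data.Bool using (Bool; true; false; T; not; _∧_; _∨_; if_then_else_)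
  open import Data.Bool.Properties using (∧-identityʳ; ∧-zeroʳ; T-∧; T-∨; T-not-≡)
  open import Data.Empty using (⊥-elim)
  open import Data.List using (List; []; _∷_; _++_; map; length; filterᵇ)
  open import Data.Nat
  open import Data.Nat.DivMod using (m≡m%n+[m/n]*n; m%n<n; m/n*n≤m; m*n/n≡m; /-monoˡ-≤)
  open import Data.Nat.Induction using (<-rec)
  open import Data.Nat.Properties
  open import Data.Nat.Tactic.RingSolver using (solve-∀)
  open import Data.Product using (_,_; proj₁; proj₂)
  open import Data.Sum using (inj₁; inj₂)
  open import Data.Unit using (tt)
  open import Function.Bundles using (Equivalence)
  open import Relation.Binary.Definitions using (Monotonic₁)
  open import Relation.Binary.PropositionalEquality
  open import Relation.Nullary using (yes; no)
  open CommSemigroupProperties +-commutativeSemigroup using () renaming (interchange to +-interchange)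
  open ≤-Reasoning
  open Partitions

  private
    variable
      A B : Set

  𝟙 : Bool → ℕ
  𝟙 b = if b then 1 else 0

  𝟙≤1 : ∀ b → 𝟙 b ≤ 1
  𝟙≤1 true  = ≤-refl
  𝟙≤1 false = z≤n

  suc-≤ᵇ-suc : ∀ m n → (suc m ≤ᵇ suc n) ≡ (m ≤ᵇ n)
  suc-≤ᵇ-suc zero    n = refl
  suc-≤ᵇ-suc (suc m) n = refl

  ≤ᵇ-true : ∀ {m n} → m ≤ n → (m ≤ᵇ n) ≡ true
  ≤ᵇ-true z≤n                     = refl
  ≤ᵇ-true {suc m} {suc n} (s≤s m≤n) = trans (suc-≤ᵇ-suc m n) (≤ᵇ-true m≤n)

  ≤ᵇ-false : ∀ {m n} → n < m → (m ≤ᵇ n) ≡ false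
  ≤ᵇ-false {suc m} {zero}  _         = refl
  ≤ᵇ-false {suc m} {suc n} (s≤s n<m) = trans (suc-≤ᵇ-suc m n) (≤ᵇ-false n<m)

  monotonic-from-suc : ∀ {f : ℕ → ℕ} → (∀ n → f n ≤ f (suc n)) → Monotonic₁ _≤_ _≤_ f
  monotonic-from-suc {f} step m≤n = go (≤⇒≤′ m≤n)
    where
    go : ∀ {m n} → m ≤′ n → f m ≤ f n
    go ≤′-refl        = ≤-refl
    go (≤′-step m≤′n) = ≤-trans (go m≤′n) (step _)

  m∸1+n<m : ∀ {m} n → suc n ≤ m → m ∸ suc n < m
  m∸1+n<m {suc m} n _ = s≤s (m∸n≤m m n)

  ^-distribʳ-* : ∀ m n k → (m * n) ^ k ≡ m ^ k * n ^ k
  ^-distribʳ-* m n zero    = refl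
  ^-distribʳ-* m n (suc k) = trans (cong (m * n *_) (^-distribʳ-* m n k)) (regroup m n (m ^ k) (n ^ k))
    where
    regroup : ∀ a b x y → a * b * (x * y) ≡ a * x * (b * y)
    regroup = solve-∀

  countᵇ : (A → Bool) → List A → ℕ
  countᵇ p []       = 0
  countᵇ p (x ∷ xs) = 𝟙 (p x) + countᵇ p xs

  length-filterᵇ : ∀ (p : A → Bool) xs → length (filterᵇ p xs) ≡ countᵇ p xs
  length-filterᵇ p []       = refl
  length-filterᵇ p (x ∷ xs) with p x
  ... | true  = cong suc (length-filterᵇ p xs)
  ... | false = length-filterᵇ p xs

  countᵇ-++ : ∀ (p : A → Bool) xs ys → countᵇ p (xs ++ ys) ≡ countᵇ p xs + countᵇ p ys
  countᵇ-++ p []       ys = refl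
  countᵇ-++ p (x ∷ xs) ys = trans (cong (𝟙 (p x) +_) (countᵇ-++ p xs ys)) (sym (+-assoc (𝟙 (p x)) _ _))

  countᵇ-map : ∀ (p : B → Bool) (f : A → B) xs → countᵇ p (map f xs) ≡ countᵇ (λ x → p (f x)) xs
  countᵇ-map p f []       = refl
  countᵇ-map p f (x ∷ xs) = cong (𝟙 (p (f x)) +_) (countᵇ-map p f xs)

  countᵇ-mono : ∀ {p q : A → Bool} → (∀ x → T (p x) → T (q x)) → ∀ xs → countᵇ p xs ≤ countᵇ q xs
  countᵇ-mono p⇒q []       = z≤n
  countᵇ-mono {p = p} {q} p⇒q (x ∷ xs) = +-mono-≤ (𝟙-mono (p x) (q x) (p⇒q x)) (countᵇ-mono p⇒q xs)
    where
    𝟙-mono : ∀ a b → (T a → T b) → 𝟙 a ≤ 𝟙 b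
    𝟙-mono false b     _   = z≤n
    𝟙-mono true  true  _   = ≤-refl
    𝟙-mono true  false a⇒b = ⊥-elim (a⇒b tt)

  countᵇ-cong : ∀ {p q : A → Bool} → (∀ x → p x ≡ q x) → ∀ xs → countᵇ p xs ≡ countᵇ q xs
  countᵇ-cong p≗q []       = refl
  countᵇ-cong p≗q (x ∷ xs) = cong₂ _+_ (cong 𝟙 (p≗q x)) (countᵇ-cong p≗q xs)

  countᵇ-∨ : ∀ (p q : A → Bool) xs → countᵇ (λ x → p x ∨ q x) xs ≤ countᵇ p xs + countᵇ q xs
  countᵇ-∨ p q []       = z≤n
  countᵇ-∨ p q (x ∷ xs) = begin
    𝟙 (p x ∨ q x) + countᵇ _ xs                     ≤⟨ +-mono-≤ (𝟙-∨ (p x) (q x)) (countᵇ-∨ p q xs) ⟩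
    𝟙 (p x) + 𝟙 (q x) + (countᵇ p xs + countᵇ q xs) ≡⟨ +-interchange (𝟙 (p x)) _ _ _ ⟩
    𝟙 (p x) + countᵇ p xs + (𝟙 (q x) + countᵇ q xs) ∎
    where
    𝟙-∨ : ∀ a b → 𝟙 (a ∨ b) ≤ 𝟙 a + 𝟙 b
    𝟙-∨ true  b = s≤s z≤n
    𝟙-∨ false b = ≤-refl

  countᵇ+countᵇ-not≡length : ∀ (p : A → Bool) xs → countᵇ p xs + countᵇ (λ x → not (p x)) xs ≡ length xs
  countᵇ+countᵇ-not≡length p []       = refl
  countᵇ+countᵇ-not≡length p (x ∷ xs) with p x
  ... | true  = cong suc (countᵇ+countᵇ-not≡length p xs)
  ... | false = trans (+-suc _ _) (cong suc (countᵇ+countᵇ-not≡length p xs))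

  countᵇ-true : ∀ (xs : List A) → countᵇ (λ _ → true) xs ≡ length xs
  countᵇ-true []       = refl
  countᵇ-true (x ∷ xs) = cong suc (countᵇ-true xs)

  countᵇ-false : ∀ (xs : List A) → countᵇ (λ _ → false) xs ≡ 0
  countᵇ-false []       = refl
  countᵇ-false (x ∷ xs) = countᵇ-false xs

  prefixSum : (ℕ → ℕ) → ℕ → ℕ
  prefixSum f zero    = f zero
  prefixSum f (suc s) = prefixSum f s + f (suc s)

  prefixSum-cong : ∀ {f g} s → (∀ n → n ≤ s → f n ≡ g n) → prefixSum f s ≡ prefixSum g s
  prefixSum-cong zero    f≗g = f≗g 0 z≤n
  prefixSum-cong (suc s) f≗g = cong₂ _+_ (prefixSum-cong s (λ n n≤s → f≗g n (m≤n⇒m≤1+n n≤s))) (f≗g (suc s) ≤-refl)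

  prefixSum-mono : ∀ {f g} s → (∀ n → n ≤ s → f n ≤ g n) → prefixSum f s ≤ prefixSum g s
  prefixSum-mono zero    f≤g = f≤g 0 z≤n
  prefixSum-mono (suc s) f≤g = +-mono-≤ (prefixSum-mono s (λ n n≤s → f≤g n (m≤n⇒m≤1+n n≤s))) (f≤g (suc s) ≤-refl)

  prefixSum-+ : ∀ f g s → prefixSum (λ n → f n + g n) s ≡ prefixSum f s + prefixSum g s
  prefixSum-+ f g zero    = refl
  prefixSum-+ f g (suc s) = trans (cong (_+ (f (suc s) + g (suc s))) (prefixSum-+ f g s))
                                  (+-interchange (prefixSum f s) (prefixSum g s) (f (suc s)) (g (suc s)))

  prefixSum≡sumFrom1 : ∀ f n → prefixSum f n ≡ f 0 + sumFrom1 f n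
  prefixSum≡sumFrom1 f zero    = sym (+-identityʳ (f 0))
  prefixSum≡sumFrom1 f (suc n) = trans (cong (_+ f (suc n)) (prefixSum≡sumFrom1 f n)) (+-assoc (f 0) _ _)

  sumFrom1-cong : ∀ {f g} n → (∀ i → i ≤ n → f i ≡ g i) → sumFrom1 f n ≡ sumFrom1 g n
  sumFrom1-cong zero    f≗g = refl
  sumFrom1-cong (suc n) f≗g = cong₂ _+_ (sumFrom1-cong n (λ i i≤n → f≗g i (m≤n⇒m≤1+n i≤n))) (f≗g (suc n) ≤-refl)

  sumFrom1-+ : ∀ f g n → sumFrom1 (λ i → f i + g i) n ≡ sumFrom1 f n + sumFrom1 g n
  sumFrom1-+ f g zero    = refl
  sumFrom1-+ f g (suc n) = trans (cong (_+ (f (suc n) + g (suc n))) (sumFrom1-+ f g n))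
                                 (+-interchange (sumFrom1 f n) (sumFrom1 g n) (f (suc n)) (g (suc n)))

  -- Stride sums

  strideInduction : ∀ k (P : ℕ → Set) → (∀ s → s < suc k → P s) →
                    (∀ s → suc k ≤ s → P (s ∸ suc k) → P s) → ∀ s → P s
  strideInduction k P base step = <-rec P rec
    where
    rec : ∀ s → (∀ {t} → t < s → P t) → P s
    rec s ih with ≤-<-connex (suc k) s
    ... | inj₁ k<s = step s k<s (ih (m∸1+n<m k k<s))
    ... | inj₂ s≤k = base s s≤k

  private
    strideSumFuel : ℕ → ℕ → (ℕ → ℕ) → ℕ → ℕ
    strideSumFuel zero     d f s = f s
    strideSumFuel (suc fu) d f s with d ≤? s
    ... | yes _ = f s + strideSumFuel fu d f (s ∸ d)
    ... | no  _ = f s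

    strideSumFuel-irrelevant : ∀ fu fu′ k f s → s < fu → s < fu′ →
                             strideSumFuel fu (suc k) f s ≡ strideSumFuel fu′ (suc k) f s
    strideSumFuel-irrelevant (suc fu) (suc fu′) k f s (s≤s s≤fu) (s≤s s≤fu′) with suc k ≤? s
    ... | yes k<s = cong (f s +_) (strideSumFuel-irrelevant fu fu′ k f (s ∸ suc k)
                      (≤-trans (m∸1+n<m k k<s) s≤fu) (≤-trans (m∸1+n<m k k<s) s≤fu′))
    ... | no  _   = refl

  -- strideSum d f s = f s + f (s ∸ d) + f (s ∸ 2d) + ⋯ , over all multiples of d up to s
  strideSum : ℕ → (ℕ → ℕ) → ℕ → ℕ
  strideSum d f s = strideSumFuel (suc s) d f s

  strideSum-≥ : ∀ k f s → suc k ≤ s → strideSum (suc k) f s ≡ f s + strideSum (suc k) f (s ∸ suc k)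
  strideSum-≥ k f s k<s with suc k ≤? s
  ... | yes _   = cong (f s +_) (strideSumFuel-irrelevant s _ k f (s ∸ suc k) (m∸1+n<m k k<s) ≤-refl)
  ... | no  k≮s = ⊥-elim (k≮s k<s)

  strideSum-< : ∀ k f s → s < suc k → strideSum (suc k) f s ≡ f s
  strideSum-< k f s s≤k with suc k ≤? s
  ... | yes k<s = ⊥-elim (<⇒≱ s≤k k<s)
  ... | no  _   = refl

  f≤strideSum : ∀ k f s → f s ≤ strideSum (suc k) f s
  f≤strideSum k f s with ≤-<-connex (suc k) s
  ... | inj₁ k<s = ≤-trans (m≤m+n (f s) _) (≤-reflexive (sym (strideSum-≥ k f s k<s)))
  ... | inj₂ s≤k = ≤-reflexive (sym (strideSum-< k f s s≤k))

  strideSum-mono : ∀ k {f g} → (∀ s → f s ≤ g s) → ∀ s → strideSum (suc k) f s ≤ strideSum (suc k) g s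
  strideSum-mono k {f} {g} f≤g = strideInduction k P base step
    where
    P : ℕ → Set
    P s = strideSum (suc k) f s ≤ strideSum (suc k) g s
    base : ∀ s → s < suc k → P s
    base s s≤k = begin
      strideSum (suc k) f s ≡⟨ strideSum-< k f s s≤k ⟩
      f s                   ≤⟨ f≤g s ⟩
      g s                   ≡⟨ strideSum-< k g s s≤k ⟨
      strideSum (suc k) g s ∎
    step : ∀ s → suc k ≤ s → P (s ∸ suc k) → P s
    step s k<s ih = begin
      strideSum (suc k) f s                 ≡⟨ strideSum-≥ k f s k<s ⟩
      f s + strideSum (suc k) f (s ∸ suc k) ≤⟨ +-mono-≤ (f≤g s) ih ⟩
      g s + strideSum (suc k) g (s ∸ suc k) ≡⟨ strideSum-≥ k g s k<s ⟨
      strideSum (suc k) g s                 ∎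

  strideSum-+ : ∀ k f g s → strideSum (suc k) (λ x → f x + g x) s ≡ strideSum (suc k) f s + strideSum (suc k) g s
  strideSum-+ k f g = strideInduction k P base step
    where
    P : ℕ → Set
    P s = strideSum (suc k) (λ x → f x + g x) s ≡ strideSum (suc k) f s + strideSum (suc k) g s
    base : ∀ s → s < suc k → P s
    base s s≤k = trans (strideSum-< k _ s s≤k) (sym (cong₂ _+_ (strideSum-< k f s s≤k) (strideSum-< k g s s≤k)))
    step : ∀ s → suc k ≤ s → P (s ∸ suc k) → P s
    step s k<s ih = begin-equality
      strideSum (suc k) (λ x → f x + g x) s                                           ≡⟨ strideSum-≥ k _ s k<s ⟩
      f s + g s + strideSum (suc k) (λ x → f x + g x) (s ∸ suc k)                     ≡⟨ cong (f s + g s +_) ih ⟩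
      f s + g s + (strideSum (suc k) f (s ∸ suc k) + strideSum (suc k) g (s ∸ suc k)) ≡⟨ +-interchange (f s) (g s) _ _ ⟩
      f s + strideSum (suc k) f (s ∸ suc k) + (g s + strideSum (suc k) g (s ∸ suc k)) ≡⟨ cong₂ _+_ (strideSum-≥ k f s k<s) (strideSum-≥ k g s k<s) ⟨
      strideSum (suc k) f s + strideSum (suc k) g s                                   ∎

  strideSum-* : ∀ k c f s → strideSum (suc k) (λ x → c * f x) s ≡ c * strideSum (suc k) f s
  strideSum-* k c f = strideInduction k P base step
    where
    P : ℕ → Set
    P s = strideSum (suc k) (λ x → c * f x) s ≡ c * strideSum (suc k) f s
    base : ∀ s → s < suc k → P s
    base s s≤k = trans (strideSum-< k _ s s≤k) (cong (c *_) (sym (strideSum-< k f s s≤k)))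
    step : ∀ s → suc k ≤ s → P (s ∸ suc k) → P s
    step s k<s ih = begin-equality
      strideSum (suc k) (λ x → c * f x) s                     ≡⟨ strideSum-≥ k _ s k<s ⟩
      c * f s + strideSum (suc k) (λ x → c * f x) (s ∸ suc k) ≡⟨ cong (c * f s +_) ih ⟩
      c * f s + c * strideSum (suc k) f (s ∸ suc k)           ≡⟨ *-distribˡ-+ c (f s) _ ⟨
      c * (f s + strideSum (suc k) f (s ∸ suc k))             ≡⟨ cong (c *_) (strideSum-≥ k f s k<s) ⟨
      c * strideSum (suc k) f s                               ∎

  strideSum-monotonic : ∀ k {f} → Monotonic₁ _≤_ _≤_ f → Monotonic₁ _≤_ _≤_ (strideSum (suc k) f)
  strideSum-monotonic k {f} f-mono = monotonic-from-suc (strideInduction k P base step)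
    where
    P : ℕ → Set
    P s = strideSum (suc k) f s ≤ strideSum (suc k) f (suc s)
    base : ∀ s → s < suc k → P s
    base s s≤k = begin
      strideSum (suc k) f s       ≡⟨ strideSum-< k f s s≤k ⟩
      f s                         ≤⟨ f-mono (n≤1+n s) ⟩
      f (suc s)                   ≤⟨ f≤strideSum k f (suc s) ⟩
      strideSum (suc k) f (suc s) ∎
    step : ∀ s → suc k ≤ s → P (s ∸ suc k) → P s
    step s k<s ih = begin
      strideSum (suc k) f s                             ≡⟨ strideSum-≥ k f s k<s ⟩
      f s + strideSum (suc k) f (s ∸ suc k)             ≤⟨ +-mono-≤ (f-mono (n≤1+n s)) ih ⟩
      f (suc s) + strideSum (suc k) f (suc (s ∸ suc k)) ≡⟨ cong (λ t → f (suc s) + strideSum (suc k) f t) (+-∸-assoc 1 k<s) ⟨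
      f (suc s) + strideSum (suc k) f (suc s ∸ suc k)   ≡⟨ strideSum-≥ k f (suc s) (m≤n⇒m≤1+n k<s) ⟨
      strideSum (suc k) f (suc s)                       ∎

  strideSum-suc≤strideSum : ∀ k {f} → Monotonic₁ _≤_ _≤_ f → ∀ s → strideSum (suc (suc k)) f s ≤ strideSum (suc k) f s
  strideSum-suc≤strideSum k {f} f-mono = strideInduction (suc k) P base step
    where
    P : ℕ → Set
    P s = strideSum (suc (suc k)) f s ≤ strideSum (suc k) f s
    base : ∀ s → s < suc (suc k) → P s
    base s s≤k+1 = ≤-trans (≤-reflexive (strideSum-< (suc k) f s s≤k+1)) (f≤strideSum k f s)
    step : ∀ s → suc (suc k) ≤ s → P (s ∸ suc (suc k)) → P s
    step s k+1<s ih = begin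
      strideSum (suc (suc k)) f s                       ≡⟨ strideSum-≥ (suc k) f s k+1<s ⟩
      f s + strideSum (suc (suc k)) f (s ∸ suc (suc k)) ≤⟨ +-monoʳ-≤ (f s) ih ⟩
      f s + strideSum (suc k) f (s ∸ suc (suc k))       ≤⟨ +-monoʳ-≤ (f s) (strideSum-monotonic k f-mono (∸-monoʳ-≤ s (n≤1+n (suc k)))) ⟩
      f s + strideSum (suc k) f (s ∸ suc k)             ≡⟨ strideSum-≥ k f s (≤-trans (n≤1+n (suc k)) k+1<s) ⟨
      strideSum (suc k) f s                             ∎

  module _ {f : ℕ → ℕ} (f-mono : Monotonic₁ _≤_ _≤_ f) where

    prefixSum≤*last : ∀ s → prefixSum f s ≤ suc s * f s
    prefixSum≤*last zero    = ≤-reflexive (sym (+-identityʳ (f 0)))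
    prefixSum≤*last (suc s) = begin
      prefixSum f s + f (suc s)     ≤⟨ +-monoˡ-≤ _ (prefixSum≤*last s) ⟩
      suc s * f s + f (suc s)       ≤⟨ +-monoˡ-≤ _ (*-monoʳ-≤ (suc s) (f-mono (n≤1+n s))) ⟩
      suc s * f (suc s) + f (suc s) ≡⟨ +-comm _ (f (suc s)) ⟩
      suc (suc s) * f (suc s)       ∎

    prefixSum-+≤ : ∀ a b → prefixSum f (a + b) ≤ prefixSum f a + b * f (a + b)
    prefixSum-+≤ a zero    = ≤-reflexive (trans (cong (prefixSum f) (+-identityʳ a)) (sym (+-identityʳ _)))
    prefixSum-+≤ a (suc b) = begin
      prefixSum f (a + suc b)                               ≡⟨ cong (prefixSum f) (+-suc a b) ⟩
      prefixSum f (a + b) + f (suc (a + b))                 ≤⟨ +-monoˡ-≤ _ (prefixSum-+≤ a b) ⟩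
      prefixSum f a + b * f (a + b) + f (suc (a + b))       ≤⟨ +-monoˡ-≤ _ (+-monoʳ-≤ (prefixSum f a) (*-monoʳ-≤ b (f-mono (n≤1+n (a + b))))) ⟩
      prefixSum f a + b * f (suc (a + b)) + f (suc (a + b)) ≡⟨ regroup (prefixSum f a) b (f (suc (a + b))) ⟩
      prefixSum f a + suc b * f (suc (a + b))               ≡⟨ cong (λ t → prefixSum f a + suc b * f t) (+-suc a b) ⟨
      prefixSum f a + suc b * f (a + suc b)                 ∎
      where
      regroup : ∀ x b y → x + b * y + y ≡ x + suc b * y
      regroup = solve-∀

    prefixSum-+≥ : ∀ a c → prefixSum f a + c * f a + f (a + suc c) ≤ prefixSum f (a + suc c)
    prefixSum-+≥ a zero    rewrite +-identityʳ (prefixSum f a) | +-comm a 1 = ≤-refl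
    prefixSum-+≥ a (suc c) = begin
      prefixSum f a + suc c * f a + f (a + suc (suc c))             ≡⟨ regroup (prefixSum f a) c (f a) _ ⟩
      prefixSum f a + c * f a + f a + f (a + suc (suc c))           ≤⟨ +-monoˡ-≤ _ (+-monoʳ-≤ (prefixSum f a + c * f a) (f-mono (m≤m+n a (suc c)))) ⟩
      prefixSum f a + c * f a + f (a + suc c) + f (a + suc (suc c)) ≤⟨ +-monoˡ-≤ _ (prefixSum-+≥ a c) ⟩
      prefixSum f (a + suc c) + f (a + suc (suc c))                 ≡⟨ cong (λ t → prefixSum f (a + suc c) + f t) (+-suc a (suc c)) ⟩
      prefixSum f (suc (a + suc c))                                 ≡⟨ cong (prefixSum f) (+-suc a (suc c)) ⟨
      prefixSum f (a + suc (suc c))                                 ∎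
      where
      regroup : ∀ x c y z → x + suc c * y + z ≡ x + c * y + y + z
      regroup = solve-∀

    prefixSum≤*strideSum : ∀ k s → prefixSum f s ≤ suc k * strideSum (suc k) f s
    prefixSum≤*strideSum k = strideInduction k P base step
      where
      P : ℕ → Set
      P s = prefixSum f s ≤ suc k * strideSum (suc k) f s
      base : ∀ s → s < suc k → P s
      base s s≤k = begin
        prefixSum f s                 ≤⟨ prefixSum≤*last s ⟩
        suc s * f s                   ≤⟨ *-monoˡ-≤ (f s) s≤k ⟩
        suc k * f s                   ≡⟨ cong (suc k *_) (strideSum-< k f s s≤k) ⟨
        suc k * strideSum (suc k) f s ∎
      step : ∀ s → suc k ≤ s → P (s ∸ suc k) → P s
      step s k<s ih = begin
        prefixSum f s                                         ≡⟨ cong (prefixSum f) (m∸n+n≡m k<s) ⟨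
        prefixSum f (a + suc k)                               ≤⟨ prefixSum-+≤ a (suc k) ⟩
        prefixSum f a + suc k * f (a + suc k)                 ≤⟨ +-monoˡ-≤ _ ih ⟩
        suc k * strideSum (suc k) f a + suc k * f (a + suc k) ≡⟨ cong (λ t → suc k * strideSum (suc k) f a + suc k * f t) (m∸n+n≡m k<s) ⟩
        suc k * strideSum (suc k) f a + suc k * f s           ≡⟨ *-distribˡ-+ (suc k) _ (f s) ⟨
        suc k * (strideSum (suc k) f a + f s)                 ≡⟨ cong (suc k *_) (trans (+-comm _ (f s)) (sym (strideSum-≥ k f s k<s))) ⟩
        suc k * strideSum (suc k) f s                         ∎
        where a = s ∸ suc k

    *strideSum≤prefixSum : ∀ k s → suc k * strideSum (suc k) f s + f s ≤ prefixSum f s + suc k * f s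
    *strideSum≤prefixSum k = strideInduction k P base step
      where
      P : ℕ → Set
      P s = suc k * strideSum (suc k) f s + f s ≤ prefixSum f s + suc k * f s
      base : ∀ s → s < suc k → P s
      base s s≤k = begin
        suc k * strideSum (suc k) f s + f s ≡⟨ cong (λ t → suc k * t + f s) (strideSum-< k f s s≤k) ⟩
        suc k * f s + f s                   ≤⟨ +-monoʳ-≤ (suc k * f s) (f≤prefixSum s) ⟩
        suc k * f s + prefixSum f s         ≡⟨ +-comm (suc k * f s) (prefixSum f s) ⟩
        prefixSum f s + suc k * f s         ∎
        where
        f≤prefixSum : ∀ s → f s ≤ prefixSum f s
        f≤prefixSum zero    = ≤-refl
        f≤prefixSum (suc s) = m≤n+m _ _
      step : ∀ s → suc k ≤ s → P (s ∸ suc k) → P s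
      step s k<s ih = +-cancelʳ-≤ (f a) _ _ (begin
        suc k * strideSum (suc k) f s + f s + f a
          ≡⟨ cong (λ t → suc k * t + f s + f a) (strideSum-≥ k f s k<s) ⟩
        suc k * (f s + strideSum (suc k) f a) + f s + f a
          ≡⟨ regroup₁ (suc k) (f s) (strideSum (suc k) f a) (f a) ⟩
        suc k * f s + f s + (suc k * strideSum (suc k) f a + f a)
          ≤⟨ +-monoʳ-≤ (suc k * f s + f s) ih ⟩
        suc k * f s + f s + (prefixSum f a + suc k * f a)
          ≡⟨ regroup₂ (suc k * f s) (f s) (prefixSum f a) k (f a) ⟩
        suc k * f s + (prefixSum f a + k * f a + f s) + f a
          ≡⟨ cong (λ t → suc k * f s + (prefixSum f a + k * f a + f t) + f a) (m∸n+n≡m k<s) ⟨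
        suc k * f s + (prefixSum f a + k * f a + f (a + suc k)) + f a
          ≤⟨ +-monoˡ-≤ (f a) (+-monoʳ-≤ (suc k * f s) (prefixSum-+≥ a k)) ⟩
        suc k * f s + prefixSum f (a + suc k) + f a
          ≡⟨ cong (λ t → suc k * f s + prefixSum f t + f a) (m∸n+n≡m k<s) ⟩
        suc k * f s + prefixSum f s + f a
          ≡⟨ cong (_+ f a) (+-comm (suc k * f s) (prefixSum f s)) ⟩
        prefixSum f s + suc k * f s + f a
          ∎)
        where
        a = s ∸ suc k
        regroup₁ : ∀ K x y z → K * (x + y) + x + z ≡ K * x + x + (K * y + z)
        regroup₁ = solve-∀
        regroup₂ : ∀ A x c k y → A + x + (c + suc k * y) ≡ A + (c + k * y + x) + y
        regroup₂ = solve-∀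

    -- Both stride sums are compared with the prefix sum, of which a stride-(k+1) sum is about a (k+1)-th.
    *strideSum-suc≤ : ∀ k s → suc (suc k) * strideSum (suc (suc k)) f s ≤ suc k * strideSum (suc k) f s + suc k * f s
    *strideSum-suc≤ k s = +-cancelʳ-≤ (f s) _ _ (begin
      suc (suc k) * strideSum (suc (suc k)) f s + f s   ≤⟨ *strideSum≤prefixSum (suc k) s ⟩
      prefixSum f s + suc (suc k) * f s                 ≤⟨ +-monoˡ-≤ _ (prefixSum≤*strideSum k s) ⟩
      suc k * strideSum (suc k) f s + suc (suc k) * f s ≡⟨ regroup (suc k * strideSum (suc k) f s) (suc k) (f s) ⟩
      suc k * strideSum (suc k) f s + suc k * f s + f s ∎)
      where
      regroup : ∀ A K x → A + suc K * x ≡ A + K * x + x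
      regroup = solve-∀

    strideSum≤2*strideSum-double : ∀ k s → strideSum (suc k) f s ≤ 2 * strideSum (suc k + suc k) f s
    strideSum≤2*strideSum-double k = strideInduction (k + suc k) P base step
      where
      d = suc k + suc k
      P : ℕ → Set
      P s = strideSum (suc k) f s ≤ 2 * strideSum d f s
      base : ∀ s → s < d → P s
      base s s<d with ≤-<-connex (suc k) s
      ... | inj₂ s≤k = begin
        strideSum (suc k) f s ≡⟨ strideSum-< k f s s≤k ⟩
        f s                   ≤⟨ m≤m+n (f s) _ ⟩
        2 * f s               ≤⟨ *-monoʳ-≤ 2 (f≤strideSum (k + suc k) f s) ⟩
        2 * strideSum d f s   ∎
      ... | inj₁ k<s = begin
        strideSum (suc k) f s                 ≡⟨ strideSum-≥ k f s k<s ⟩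
        f s + strideSum (suc k) f (s ∸ suc k) ≡⟨ cong (f s +_) (strideSum-< k f (s ∸ suc k) s-k≤k) ⟩
        f s + f (s ∸ suc k)                   ≤⟨ +-monoʳ-≤ (f s) (f-mono (m∸n≤m s (suc k))) ⟩
        f s + f s                             ≡⟨ cong (f s +_) (+-identityʳ (f s)) ⟨
        2 * f s                               ≡⟨ cong (2 *_) (strideSum-< (k + suc k) f s s<d) ⟨
        2 * strideSum d f s                   ∎
        where
        s-k≤k : s ∸ suc k < suc k
        s-k≤k = +-cancelʳ-< _ _ (suc k) (≤-trans (≤-reflexive (cong suc (m∸n+n≡m k<s))) s<d)
      step : ∀ s → d ≤ s → P (s ∸ d) → P s
      step s d≤s ih = begin
        strideSum (suc k) f s
          ≡⟨ strideSum-≥ k f s k<s ⟩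
        f s + strideSum (suc k) f (s ∸ suc k)
          ≡⟨ cong (f s +_) (strideSum-≥ k f (s ∸ suc k) k<s-k) ⟩
        f s + (f (s ∸ suc k) + strideSum (suc k) f (s ∸ suc k ∸ suc k))
          ≡⟨ cong (λ t → f s + (f (s ∸ suc k) + strideSum (suc k) f t)) (∸-+-assoc s (suc k) (suc k)) ⟩
        f s + (f (s ∸ suc k) + strideSum (suc k) f (s ∸ d))
          ≤⟨ +-monoʳ-≤ (f s) (+-mono-≤ (f-mono (m∸n≤m s (suc k))) ih) ⟩
        f s + (f s + 2 * strideSum d f (s ∸ d))
          ≡⟨ regroup (f s) (strideSum d f (s ∸ d)) ⟩
        2 * (f s + strideSum d f (s ∸ d))
          ≡⟨ cong (2 *_) (strideSum-≥ (k + suc k) f s d≤s) ⟨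
        2 * strideSum d f s
          ∎
        where
        k<s : suc k ≤ s
        k<s = ≤-trans (m≤m+n (suc k) (suc k)) d≤s
        k<s-k : suc k ≤ s ∸ suc k
        k<s-k = ≤-trans (≤-reflexive (sym (m+n∸n≡m (suc k) (suc k)))) (∸-monoˡ-≤ (suc k) d≤s)
        regroup : ∀ x y → x + (x + 2 * y) ≡ 2 * (x + y)
        regroup = solve-∀

    *≤strideSum : ∀ k j s → suc k * j ≤ s → suc j * f (s ∸ suc k * j) ≤ strideSum (suc k) f s
    *≤strideSum k zero s _ = begin
      f (s ∸ suc k * 0) + 0 ≡⟨ trans (+-identityʳ _) (cong (λ t → f (s ∸ t)) (*-zeroʳ k)) ⟩
      f s                   ≤⟨ f≤strideSum k f s ⟩
      strideSum (suc k) f s ∎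
    *≤strideSum k (suc j) s kj≤s = begin
      suc (suc j) * f (s ∸ suc k * suc j)
        ≡⟨⟩
      f (s ∸ suc k * suc j) + suc j * f (s ∸ suc k * suc j)
        ≤⟨ +-mono-≤ (f-mono (m∸n≤m s (suc k * suc j))) (≤-reflexive (cong (λ t → suc j * f t) s-k-kj)) ⟩
      f s + suc j * f (s ∸ suc k ∸ suc k * j)
        ≤⟨ +-monoʳ-≤ (f s) (*≤strideSum k j (s ∸ suc k) kj≤s-k) ⟩
      f s + strideSum (suc k) f (s ∸ suc k)
        ≡⟨ strideSum-≥ k f s k<s ⟨
      strideSum (suc k) f s
        ∎
      where
      kj+k≤s : suc k * j + suc k ≤ s
      kj+k≤s = ≤-trans (≤-reflexive (trans (+-comm _ (suc k)) (sym (*-suc (suc k) j)))) kj≤s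
      k<s : suc k ≤ s
      k<s = ≤-trans (m≤n+m (suc k) _) kj+k≤s
      kj≤s-k : suc k * j ≤ s ∸ suc k
      kj≤s-k = ≤-trans (≤-reflexive (sym (m+n∸n≡m _ (suc k)))) (∸-monoˡ-≤ (suc k) kj+k≤s)
      s-k-kj : s ∸ suc k * suc j ≡ s ∸ suc k ∸ suc k * j
      s-k-kj = trans (cong (s ∸_) (*-suc (suc k) j)) (sym (∸-+-assoc s (suc k) (suc k * j)))

  strideSum-double : ∀ k f t → strideSum (suc k + suc k) f (t + t) ≡ strideSum (suc k) (λ u → f (u + u)) t
  strideSum-double k f = strideInduction k P base step
    where
    P : ℕ → Set
    P t = strideSum (suc k + suc k) f (t + t) ≡ strideSum (suc k) (λ u → f (u + u)) t
    base : ∀ t → t < suc k → P t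
    base t t≤k = trans (strideSum-< (k + suc k) f (t + t) (+-mono-< t≤k t≤k)) (sym (strideSum-< k _ t t≤k))
    step : ∀ t → suc k ≤ t → P (t ∸ suc k) → P t
    step t k<t ih = begin-equality
      strideSum (suc k + suc k) f (t + t)                                 ≡⟨ strideSum-≥ (k + suc k) f (t + t) (+-mono-≤ k<t k<t) ⟩
      f (t + t) + strideSum (suc k + suc k) f (t + t ∸ (suc k + suc k))   ≡⟨ cong (λ u → f (t + t) + strideSum (suc k + suc k) f u) (double-∸ k<t) ⟩
      f (t + t) + strideSum (suc k + suc k) f ((t ∸ suc k) + (t ∸ suc k)) ≡⟨ cong (f (t + t) +_) ih ⟩
      f (t + t) + strideSum (suc k) (λ u → f (u + u)) (t ∸ suc k)         ≡⟨ strideSum-≥ k _ t k<t ⟨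
      strideSum (suc k) (λ u → f (u + u)) t                               ∎
      where
      double-∸ : ∀ {m t} → m ≤ t → t + t ∸ (m + m) ≡ (t ∸ m) + (t ∸ m)
      double-∸ {m} {t} m≤t = begin-equality
        t + t ∸ (m + m)   ≡⟨ ∸-+-assoc (t + t) m m ⟨
        t + t ∸ m ∸ m     ≡⟨ cong (_∸ m) (+-∸-assoc t m≤t) ⟩
        t + (t ∸ m) ∸ m   ≡⟨ cong (_∸ m) (+-comm t (t ∸ m)) ⟩
        (t ∸ m) + t ∸ m   ≡⟨ +-∸-assoc (t ∸ m) m≤t ⟩
        (t ∸ m) + (t ∸ m) ∎

  -- Cumulative partition numbers

  -- The parts outside {1, 2, 4} are the cyclic factors counted by uCount and wCount.
  outside124 : ℕ → Bool
  outside124 0 = false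
  outside124 1 = false
  outside124 2 = false
  outside124 3 = true
  outside124 4 = false
  outside124 (suc (suc (suc (suc (suc _))))) = true

  outside124-≥5 : ∀ k → 5 ≤ k → outside124 k ≡ true
  outside124-≥5 _ (s≤s (s≤s (s≤s (s≤s (s≤s _))))) = refl

  padded : ℕ → ℕ
  padded k = if outside124 k then suc k else k

  -- cumParts m s counts the partitions of size ≤ s into parts ≤ m; cumPaddedParts does the same
  -- when each part outside {1, 2, 4} is padded by one.
  cumParts : ℕ → ℕ → ℕ
  cumParts zero    s = 1
  cumParts (suc m) s = strideSum (suc m) (cumParts m) s

  cumPaddedParts : ℕ → ℕ → ℕ
  cumPaddedParts zero    s = 1
  cumPaddedParts (suc m) s = strideSum (padded (suc m)) (cumPaddedParts m) s

  cumParts-monotonic : ∀ m → Monotonic₁ _≤_ _≤_ (cumParts m)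
  cumParts-monotonic zero    _ = ≤-refl
  cumParts-monotonic (suc m)   = strideSum-monotonic m (cumParts-monotonic m)

  cumParts-monoˡ : ∀ s → Monotonic₁ _≤_ _≤_ (λ m → cumParts m s)
  cumParts-monoˡ s = monotonic-from-suc (λ m → f≤strideSum m (cumParts m) s)

  padded-suc : ∀ m → padded (suc m) ≡ suc (m + 𝟙 (outside124 (suc m)))
  padded-suc m with outside124 (suc m)
  ... | true  = cong suc (+-comm 1 m)
  ... | false = cong suc (sym (+-identityʳ m))

  cumPaddedParts-suc : ∀ m t → cumPaddedParts (suc m) t ≡ strideSum (suc (m + 𝟙 (outside124 (suc m)))) (cumPaddedParts m) t
  cumPaddedParts-suc m t = cong (λ d → strideSum d (cumPaddedParts m) t) (padded-suc m)

  cumPaddedParts-monoˡ : ∀ m t → cumPaddedParts m t ≤ cumPaddedParts (suc m) t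
  cumPaddedParts-monoˡ m t = ≤-trans (f≤strideSum (m + 𝟙 (outside124 (suc m))) (cumPaddedParts m) t)
                                     (≤-reflexive (sym (cumPaddedParts-suc m t)))

  cumParts-double : ∀ m t → cumParts m (t + t) ≤ 2 ^ m * cumParts m t
  cumParts-double zero    t = s≤s z≤n
  cumParts-double (suc m) t = begin
    strideSum (suc m) (cumParts m) (t + t)               ≤⟨ strideSum≤2*strideSum-double (cumParts-monotonic m) m (t + t) ⟩
    2 * strideSum (suc m + suc m) (cumParts m) (t + t)   ≡⟨ cong (2 *_) (strideSum-double m (cumParts m) t) ⟩
    2 * strideSum (suc m) (λ u → cumParts m (u + u)) t   ≤⟨ *-monoʳ-≤ 2 (strideSum-mono m (cumParts-double m) t) ⟩
    2 * strideSum (suc m) (λ u → 2 ^ m * cumParts m u) t ≡⟨ cong (2 *_) (strideSum-* m (2 ^ m) (cumParts m) t) ⟩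
    2 * (2 ^ m * strideSum (suc m) (cumParts m) t)       ≡⟨ *-assoc 2 (2 ^ m) _ ⟨
    2 ^ suc m * cumParts (suc m) t                       ∎

  -- Along a stride of 2(m+1)j ≤ s, cumParts (suc m) s collects j+1 values of cumParts m, each at least
  -- cumParts m (s/2) ≥ cumParts m s / 2^m.
  *cumParts≤cumParts-suc : ∀ m j s → suc m * j + suc m * j ≤ s → suc j * cumParts m s ≤ 2 ^ m * cumParts (suc m) s
  *cumParts≤cumParts-suc m j s 2mj≤s = begin
    suc j * cumParts m s           ≤⟨ *-monoʳ-≤ (suc j) (cumParts-monotonic m s≤t+t) ⟩
    suc j * cumParts m (t + t)     ≤⟨ *-monoʳ-≤ (suc j) (cumParts-double m t) ⟩
    suc j * (2 ^ m * cumParts m t) ≡⟨ x∙yz≈y∙xz (suc j) (2 ^ m) (cumParts m t) ⟩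
    2 ^ m * (suc j * cumParts m t) ≤⟨ *-monoʳ-≤ (2 ^ m) (*≤strideSum (cumParts-monotonic m) m j s mj≤s) ⟩
    2 ^ m * cumParts (suc m) s     ∎
    where
    open CommSemigroupProperties *-commutativeSemigroup using (x∙yz≈y∙xz)
    t = s ∸ suc m * j
    mj≤s : suc m * j ≤ s
    mj≤s = ≤-trans (m≤m+n _ _) 2mj≤s
    s≤t+t : s ≤ t + t
    s≤t+t = begin
      s             ≡⟨ m∸n+n≡m mj≤s ⟨
      t + suc m * j ≤⟨ +-monoʳ-≤ t (≤-trans (≤-reflexive (sym (m+n∸n≡m _ (suc m * j)))) (∸-monoˡ-≤ (suc m * j) 2mj≤s)) ⟩
      t + t         ∎

  ∏outside124 : ℕ → ℕ
  ∏outside124 zero    = 1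
  ∏outside124 (suc m) = if outside124 (suc m) then suc m * ∏outside124 m else ∏outside124 m

  ∏suc-outside124 : ℕ → ℕ
  ∏suc-outside124 zero    = 1
  ∏suc-outside124 (suc m) = if outside124 (suc m) then suc (suc m) * ∏suc-outside124 m else ∏suc-outside124 m

  correction : ℕ → ℕ
  correction zero    = 0
  correction (suc m) = if outside124 (suc m) then suc (2 * correction m) else correction m

  paddedBound : ℕ → ℕ → ℕ
  paddedBound m s = cumParts m s + correction m * cumParts (pred m) s

  strideSum-paddedBound : ∀ m s → strideSum (suc m) (paddedBound m) s ≤ cumParts (suc m) s + correction m * cumParts m s
  strideSum-paddedBound m s = begin
    strideSum (suc m) (paddedBound m) s
      ≡⟨ strideSum-+ m (cumParts m) _ s ⟩
    cumParts (suc m) s + strideSum (suc m) (λ x → correction m * cumParts (pred m) x) s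
      ≡⟨ cong (cumParts (suc m) s +_) (strideSum-* m (correction m) (cumParts (pred m)) s) ⟩
    cumParts (suc m) s + correction m * strideSum (suc m) (cumParts (pred m)) s
      ≤⟨ +-monoʳ-≤ (cumParts (suc m) s) (correction-term m) ⟩
    cumParts (suc m) s + correction m * cumParts m s
      ∎
    where
    correction-term : ∀ m → correction m * strideSum (suc m) (cumParts (pred m)) s ≤ correction m * cumParts m s
    correction-term zero    = ≤-refl
    correction-term (suc m) = *-monoʳ-≤ (correction (suc m)) (strideSum-suc≤strideSum m (cumParts-monotonic m) s)

  -- In generating-function terms, padding the part k multiplies by (1 - x^k)/(1 - x^(k+1)) ≈ k/(k+1);
  -- correction m collects the error terms of *strideSum-suc≤.
  ∏suc*cumPaddedParts≤ : ∀ m s → ∏suc-outside124 m * cumPaddedParts m s ≤ ∏outside124 m * paddedBound m s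
  ∏suc*cumPaddedParts≤ zero    s = s≤s z≤n
  ∏suc*cumPaddedParts≤ (suc m) s with outside124 (suc m)
  ... | false = begin
    ∏suc-outside124 m * strideSum (suc m) (cumPaddedParts m) s         ≡⟨ strideSum-* m (∏suc-outside124 m) (cumPaddedParts m) s ⟨
    strideSum (suc m) (λ x → ∏suc-outside124 m * cumPaddedParts m x) s ≤⟨ strideSum-mono m (∏suc*cumPaddedParts≤ m) s ⟩
    strideSum (suc m) (λ x → ∏outside124 m * paddedBound m x) s        ≡⟨ strideSum-* m (∏outside124 m) (paddedBound m) s ⟩
    ∏outside124 m * strideSum (suc m) (paddedBound m) s                ≤⟨ *-monoʳ-≤ (∏outside124 m) (strideSum-paddedBound m s) ⟩
    ∏outside124 m * (cumParts (suc m) s + correction m * cumParts m s) ∎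
  ... | true = begin
    suc (suc m) * ∏suc-outside124 m * strideSum (suc (suc m)) (cumPaddedParts m) s
      ≡⟨ *-assoc (suc (suc m)) (∏suc-outside124 m) (strideSum (suc (suc m)) (cumPaddedParts m) s) ⟩
    suc (suc m) * (∏suc-outside124 m * strideSum (suc (suc m)) (cumPaddedParts m) s)
      ≡⟨ cong (suc (suc m) *_) (strideSum-* (suc m) (∏suc-outside124 m) (cumPaddedParts m) s) ⟨
    suc (suc m) * strideSum (suc (suc m)) (λ x → ∏suc-outside124 m * cumPaddedParts m x) s
      ≤⟨ *-monoʳ-≤ (suc (suc m)) (strideSum-mono (suc m) (∏suc*cumPaddedParts≤ m) s) ⟩
    suc (suc m) * strideSum (suc (suc m)) (λ x → ∏outside124 m * paddedBound m x) s
      ≡⟨ cong (suc (suc m) *_) (strideSum-* (suc m) (∏outside124 m) (paddedBound m) s) ⟩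
    suc (suc m) * (∏outside124 m * strideSum (suc (suc m)) (paddedBound m) s)
      ≡⟨ x∙yz≈y∙xz (suc (suc m)) (∏outside124 m) _ ⟩
    ∏outside124 m * (suc (suc m) * strideSum (suc (suc m)) (paddedBound m) s)
      ≤⟨ *-monoʳ-≤ (∏outside124 m) (*strideSum-suc≤ (paddedBound-monotonic m) m s) ⟩
    ∏outside124 m * (suc m * strideSum (suc m) (paddedBound m) s + suc m * paddedBound m s)
      ≡⟨ regroup₁ (∏outside124 m) (suc m) (strideSum (suc m) (paddedBound m) s) (paddedBound m s) ⟩
    suc m * ∏outside124 m * (strideSum (suc m) (paddedBound m) s + paddedBound m s)
      ≤⟨ *-monoʳ-≤ (suc m * ∏outside124 m) (+-mono-≤ (strideSum-paddedBound m s) paddedBound≤) ⟩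
    suc m * ∏outside124 m * (cumParts (suc m) s + correction m * cumParts m s + (cumParts m s + correction m * cumParts m s))
      ≡⟨ cong (suc m * ∏outside124 m *_) (regroup₂ (cumParts (suc m) s) (correction m) (cumParts m s)) ⟩
    suc m * ∏outside124 m * (cumParts (suc m) s + suc (2 * correction m) * cumParts m s)
      ∎
    where
    open CommSemigroupProperties *-commutativeSemigroup using (x∙yz≈y∙xz)
    paddedBound-monotonic : ∀ m → Monotonic₁ _≤_ _≤_ (paddedBound m)
    paddedBound-monotonic m x≤y = +-mono-≤ (cumParts-monotonic m x≤y) (*-monoʳ-≤ (correction m) (cumParts-monotonic (pred m) x≤y))
    paddedBound≤ : paddedBound m s ≤ cumParts m s + correction m * cumParts m s
    paddedBound≤ = +-monoʳ-≤ (cumParts m s) (*-monoʳ-≤ (correction m) (cumParts-monoˡ s (pred[n]≤n {m})))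
    regroup₁ : ∀ p a x y → p * (a * x + a * y) ≡ a * p * (x + y)
    regroup₁ = solve-∀
    regroup₂ : ∀ a c b → a + c * b + (b + c * b) ≡ a + suc (2 * c) * b
    regroup₂ = solve-∀

  ∏suc-outside124-ratio : ∀ m → 5 ≤ m → 4 * suc m * ∏outside124 m ≡ 15 * ∏suc-outside124 m
  ∏suc-outside124-ratio m 5≤m = go (≤⇒≤′ 5≤m)
    where
    go : ∀ {m} → 5 ≤′ m → 4 * suc m * ∏outside124 m ≡ 15 * ∏suc-outside124 m
    go ≤′-refl = refl
    go {suc m} (≤′-step 5≤′m) rewrite outside124-≥5 (suc m) (m≤n⇒m≤1+n (≤′⇒≤ 5≤′m)) = begin-equality
      4 * suc (suc m) * (suc m * ∏outside124 m) ≡⟨ regroup₁ (suc (suc m)) (suc m) (∏outside124 m) ⟩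
      suc (suc m) * (4 * suc m * ∏outside124 m) ≡⟨ cong (suc (suc m) *_) (go 5≤′m) ⟩
      suc (suc m) * (15 * ∏suc-outside124 m)    ≡⟨ regroup₂ (suc (suc m)) (∏suc-outside124 m) ⟩
      15 * (suc (suc m) * ∏suc-outside124 m)    ∎
      where
      regroup₁ : ∀ a b c → 4 * a * (b * c) ≡ a * (4 * b * c)
      regroup₁ = solve-∀
      regroup₂ : ∀ a b → a * (15 * b) ≡ 15 * (a * b)
      regroup₂ = solve-∀

  ∏outside124-positive : ∀ m → 1 ≤ ∏outside124 m
  ∏outside124-positive zero = ≤-refl
  ∏outside124-positive (suc m) with outside124 (suc m)
  ... | true  = ≤-trans (∏outside124-positive m) (m≤n*m (∏outside124 m) (suc m))
  ... | false = ∏outside124-positive m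

  paddedThreshold : ℕ → ℕ
  paddedThreshold L = L * j + L * j
    where j = 15 * correction L * 2 ^ pred L

  cumPaddedParts-sparse : ∀ L s → 5 ≤ L → paddedThreshold L ≤ s → suc L * cumPaddedParts L s ≤ 4 * cumParts L s
  cumPaddedParts-sparse L@(suc L′) s 5≤L threshold≤s = *-cancelˡ-≤ 4 (*-cancelˡ-≤ (∏outside124 L) (begin
    ∏outside124 L * (4 * (suc L * cumPaddedParts L s))
      ≡⟨ regroup₁ (∏outside124 L) (suc L) (cumPaddedParts L s) ⟩
    4 * suc L * ∏outside124 L * cumPaddedParts L s
      ≡⟨ cong (_* cumPaddedParts L s) (∏suc-outside124-ratio L 5≤L) ⟩
    15 * ∏suc-outside124 L * cumPaddedParts L s
      ≡⟨ *-assoc 15 (∏suc-outside124 L) _ ⟩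
    15 * (∏suc-outside124 L * cumPaddedParts L s)
      ≤⟨ *-monoʳ-≤ 15 (∏suc*cumPaddedParts≤ L s) ⟩
    15 * (∏outside124 L * (cumParts L s + correction L * cumParts L′ s))
      ≡⟨ regroup₂ (∏outside124 L) (cumParts L s) (correction L * cumParts L′ s) ⟩
    ∏outside124 L * (15 * cumParts L s + 15 * (correction L * cumParts L′ s))
      ≤⟨ *-monoʳ-≤ (∏outside124 L) (+-monoʳ-≤ (15 * cumParts L s) correction-small) ⟩
    ∏outside124 L * (15 * cumParts L s + cumParts L s)
      ≡⟨ cong (∏outside124 L *_) (regroup₃ (cumParts L s)) ⟩
    ∏outside124 L * (4 * (4 * cumParts L s))
      ∎))
    where
    instance
      ∏outside124-nonZero : NonZero (∏outside124 L)
      ∏outside124-nonZero = >-nonZero (∏outside124-positive L)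
      2^L′-nonZero : NonZero (2 ^ L′)
      2^L′-nonZero = >-nonZero (m^n>0 2 L′)
    j = 15 * correction L * 2 ^ L′
    regroup₄ : ∀ p c a → p * (15 * (c * a)) ≡ 15 * c * p * a
    regroup₄ = solve-∀
    correction-small : 15 * (correction L * cumParts L′ s) ≤ cumParts L s
    correction-small = *-cancelˡ-≤ (2 ^ L′) (begin
      2 ^ L′ * (15 * (correction L * cumParts L′ s)) ≡⟨ regroup₄ (2 ^ L′) (correction L) (cumParts L′ s) ⟩
      j * cumParts L′ s                              ≤⟨ *-monoˡ-≤ (cumParts L′ s) (n≤1+n j) ⟩
      suc j * cumParts L′ s                          ≤⟨ *cumParts≤cumParts-suc L′ j s threshold≤s ⟩
      2 ^ L′ * cumParts L s                          ∎)
    regroup₁ : ∀ p a b → p * (4 * (a * b)) ≡ 4 * a * p * b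
    regroup₁ = solve-∀
    regroup₂ : ∀ p a b → 15 * (p * (a + b)) ≡ p * (15 * a + 15 * b)
    regroup₂ = solve-∀
    regroup₃ : ∀ a → 15 * a + a ≡ 4 * (4 * a)
    regroup₃ = solve-∀

  -- Counting partitions with a property

  countParts : (List ℕ → Bool) → ℕ → ℕ → ℕ
  countParts p n m = countᵇ p (parts n m)

  countParts-< : ∀ p n m → n ≤ m → countParts p n (suc m) ≡ countParts p n m
  countParts-< p n m n≤m = cong (countᵇ p) (parts-< n m n≤m)

  countParts-≥ : ∀ p n m → suc m ≤ n →
                 countParts p n (suc m) ≡ countParts p n m + countParts (λ l → p (suc m ∷ l)) (n ∸ suc m) (suc m)
  countParts-≥ p n m m<n = begin-equality
    countᵇ p (parts n (suc m))
      ≡⟨ cong (countᵇ p) (parts-≥ n m m<n) ⟩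
    countᵇ p (parts n m ++ map (suc m ∷_) (parts (n ∸ suc m) (suc m)))
      ≡⟨ countᵇ-++ p (parts n m) _ ⟩
    countParts p n m + countᵇ p (map (suc m ∷_) (parts (n ∸ suc m) (suc m)))
      ≡⟨ cong (countParts p n m +_) (countᵇ-map p (suc m ∷_) (parts (n ∸ suc m) (suc m))) ⟩
    countParts p n m + countParts (λ l → p (suc m ∷ l)) (n ∸ suc m) (suc m)
      ∎

  cumCount : (List ℕ → Bool) → ℕ → ℕ → ℕ
  cumCount p s m = prefixSum (λ n → countParts p n m) s

  cumCount-< : ∀ p s m → s ≤ m → cumCount p s (suc m) ≡ cumCount p s m
  cumCount-< p s m s≤m = prefixSum-cong s (λ n n≤s → countParts-< p n m (≤-trans n≤s s≤m))

  cumCount-≥ : ∀ p s m → suc m ≤ s →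
               cumCount p s (suc m) ≡ cumCount p s m + cumCount (λ l → p (suc m ∷ l)) (s ∸ suc m) (suc m)
  cumCount-≥ p s m m<s = subst (λ t → cumCount p t (suc m) ≡ cumCount p t m + cumCount p′ (s ∸ suc m) (suc m))
                               (m∸n+n≡m m<s) (go (s ∸ suc m))
    where
    p′ = λ l → p (suc m ∷ l)
    go : ∀ j → cumCount p (j + suc m) (suc m) ≡ cumCount p (j + suc m) m + cumCount p′ j (suc m)
    go zero    = begin-equality
      cumCount p m (suc m) + countParts p (suc m) (suc m)
        ≡⟨ cong₂ _+_ (cumCount-< p m m ≤-refl) (countParts-≥ p (suc m) m ≤-refl) ⟩
      cumCount p m m + (countParts p (suc m) m + countParts p′ (m ∸ m) (suc m))
        ≡⟨ +-assoc (cumCount p m m) _ _ ⟨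
      cumCount p m m + countParts p (suc m) m + countParts p′ (m ∸ m) (suc m)
        ≡⟨ cong (λ k → cumCount p m m + countParts p (suc m) m + countParts p′ k (suc m)) (n∸n≡0 m) ⟩
      cumCount p m m + countParts p (suc m) m + cumCount p′ 0 (suc m)
        ∎
    go (suc j) = begin-equality
      cumCount p (j + suc m) (suc m) + countParts p (suc (j + suc m)) (suc m)
        ≡⟨ cong₂ _+_ (go j) (countParts-≥ p (suc (j + suc m)) m (m≤n⇒m≤1+n (m≤n+m (suc m) j))) ⟩
      cumCount p (j + suc m) m + cumCount p′ j (suc m) + (countParts p (suc (j + suc m)) m + countParts p′ (suc j + suc m ∸ suc m) (suc m))
        ≡⟨ cong (λ k → cumCount p (j + suc m) m + cumCount p′ j (suc m) + (countParts p (suc (j + suc m)) m + countParts p′ k (suc m)))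
                (m+n∸n≡m (suc j) (suc m)) ⟩
      cumCount p (j + suc m) m + cumCount p′ j (suc m) + (countParts p (suc (j + suc m)) m + countParts p′ (suc j) (suc m))
        ≡⟨ +-interchange (cumCount p (j + suc m) m) (cumCount p′ j (suc m)) (countParts p (suc (j + suc m)) m) (countParts p′ (suc j) (suc m)) ⟩
      cumCount p (suc j + suc m) m + cumCount p′ (suc j) (suc m) ∎

  cumCount-mono : ∀ {p q} → (∀ l → T (p l) → T (q l)) → ∀ s m → cumCount p s m ≤ cumCount q s m
  cumCount-mono p⇒q s m = prefixSum-mono s (λ n _ → countᵇ-mono p⇒q (parts n m))

  cumCount-cong : ∀ {p q} → (∀ l → p l ≡ q l) → ∀ s m → cumCount p s m ≡ cumCount q s m
  cumCount-cong p≗q s m = prefixSum-cong s (λ n _ → countᵇ-cong p≗q (parts n m))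

  cumCount-∨ : ∀ p q s m → cumCount (λ l → p l ∨ q l) s m ≤ cumCount p s m + cumCount q s m
  cumCount-∨ p q s m = ≤-trans (prefixSum-mono s (λ n _ → countᵇ-∨ p q (parts n m)))
                               (≤-reflexive (prefixSum-+ (λ n → countParts p n m) (λ n → countParts q n m) s))

  cumCount-≡0 : ∀ p s m → (∀ n → n ≤ s → countParts p n m ≡ 0) → cumCount p s m ≡ 0
  cumCount-≡0 p zero    m none = none 0 z≤n
  cumCount-≡0 p (suc s) m none = cong₂ _+_ (cumCount-≡0 p s m (λ n n≤s → none n (m≤n⇒m≤1+n n≤s))) (none (suc s) ≤-refl)

  cumCount-[] : ∀ p s → cumCount p s 0 ≡ 𝟙 (p [])
  cumCount-[] p zero    = +-identityʳ _
  cumCount-[] p (suc s) = trans (+-identityʳ _) (cumCount-[] p s)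

  cumCount-all : ∀ m s → cumCount (λ _ → true) s m ≡ cumParts m s
  cumCount-all zero    s = cumCount-[] _ s
  cumCount-all (suc m)   = strideInduction m P base step
    where
    P : ℕ → Set
    P s = cumCount (λ _ → true) s (suc m) ≡ cumParts (suc m) s
    base : ∀ s → s < suc m → P s
    base s s≤m = trans (cumCount-< _ s m (≤-pred s≤m)) (trans (cumCount-all m s) (sym (strideSum-< m (cumParts m) s s≤m)))
    step : ∀ s → suc m ≤ s → P (s ∸ suc m) → P s
    step s m<s ih = trans (cumCount-≥ _ s m m<s) (trans (cong₂ _+_ (cumCount-all m s) ih) (sym (strideSum-≥ m (cumParts m) s m<s)))

  -- Q r l says that l still has to cover r; a partition of n < r never does.
  countParts-vanish : ∀ (Q : ℕ → List ℕ → Bool) → (∀ r → Q (suc r) [] ≡ false) →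
                      (∀ r k l → suc k < r → T (Q r (suc k ∷ l)) → T (Q (r ∸ suc k) l)) →
                      ∀ m n r → n < r → countParts (Q r) n m ≡ 0
  countParts-vanish Q Q[] Q∷ zero    zero    (suc r) _   = cong (λ b → 𝟙 b + 0) (Q[] r)
  countParts-vanish Q Q[] Q∷ zero    (suc n) r       _   = refl
  countParts-vanish Q Q[] Q∷ (suc m) n       r       n<r = <-rec P go n r n<r
    where
    P : ℕ → Set
    P n = ∀ r → n < r → countParts (Q r) n (suc m) ≡ 0
    go : ∀ n → (∀ {n′} → n′ < n → P n′) → P n
    go n ih r n<r with ≤-<-connex (suc m) n
    ... | inj₂ n≤m = trans (countParts-< (Q r) n m (≤-pred n≤m)) (countParts-vanish Q Q[] Q∷ m n r n<r)
    ... | inj₁ m<n = trans (countParts-≥ (Q r) n m m<n)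
                           (cong₂ _+_ (countParts-vanish Q Q[] Q∷ m n r n<r) (n≤0⇒n≡0 rest≤0))
      where
      rest≤0 : countParts (λ l → Q r (suc m ∷ l)) (n ∸ suc m) (suc m) ≤ 0
      rest≤0 = begin
        countParts (λ l → Q r (suc m ∷ l)) (n ∸ suc m) (suc m) ≤⟨ countᵇ-mono (λ l → Q∷ r m l (≤-<-trans m<n n<r)) (parts (n ∸ suc m) (suc m)) ⟩
        countParts (Q (r ∸ suc m)) (n ∸ suc m) (suc m)         ≡⟨ ih (m∸1+n<m m m<n) (r ∸ suc m) (∸-monoˡ-< n<r m<n) ⟩
        0                                                      ∎

  -- Partitions with many parts 1

  outsideCount : ℕ → List ℕ → ℕ
  outsideCount L []      = 0
  outsideCount L (k ∷ l) = 𝟙 (outside124 k ∧ (k ≤ᵇ L)) + outsideCount L l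

  onesDominate : ℕ → ℕ → List ℕ → Bool
  onesDominate L δ l = outsideCount L l + δ ≤ᵇ vCount l

  onesDominate-vanish : ∀ L m n δ → n < δ → countParts (onesDominate L δ) n m ≡ 0
  onesDominate-vanish L = countParts-vanish (onesDominate L) (λ _ → refl) drop
    where
    drop : ∀ r k l → suc k < r → T (onesDominate L r (suc k ∷ l)) → T (onesDominate L (r ∸ suc k) l)
    drop (suc zero)    zero    l (s≤s ()) _
    drop (suc (suc d)) zero    l _ dom = ≤⇒≤ᵇ (≤-pred (begin
      suc (outsideCount L l + suc d) ≡⟨ +-suc (outsideCount L l) (suc d) ⟨
      outsideCount L l + suc (suc d) ≤⟨ ≤ᵇ⇒≤ (outsideCount L l + suc (suc d)) (suc (vCount l)) dom ⟩
      suc (vCount l)                 ∎))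
    drop r             (suc k) l _ dom = ≤⇒≤ᵇ (begin
      outsideCount L l + (r ∸ suc (suc k)) ≤⟨ +-monoʳ-≤ (outsideCount L l) (m∸n≤m r (suc (suc k))) ⟩
      outsideCount L l + r                 ≤⟨ +-monoˡ-≤ r (m≤n+m (outsideCount L l) (𝟙 (outside124 (suc (suc k)) ∧ (suc (suc k) ≤ᵇ L)))) ⟩
      outsideCount L (suc (suc k) ∷ l) + r ≤⟨ ≤ᵇ⇒≤ (outsideCount L (suc (suc k) ∷ l) + r) (vCount l) dom ⟩
      vCount l                             ∎)

  onesDominate-∷ : ∀ L δ k l → suc (suc k) ≤ L →
                   onesDominate L δ (suc (suc k) ∷ l) ≡ onesDominate L (δ + 𝟙 (outside124 (suc (suc k)))) l
  onesDominate-∷ L δ k l k+2≤L = cong (_≤ᵇ vCount l) (begin-equality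
    𝟙 (outside124 (suc (suc k)) ∧ (suc (suc k) ≤ᵇ L)) + outsideCount L l + δ
      ≡⟨ cong (λ b → 𝟙 (outside124 (suc (suc k)) ∧ b) + outsideCount L l + δ) (≤ᵇ-true k+2≤L) ⟩
    𝟙 (outside124 (suc (suc k)) ∧ true) + outsideCount L l + δ
      ≡⟨ cong (λ b → 𝟙 b + outsideCount L l + δ) (∧-identityʳ (outside124 (suc (suc k)))) ⟩
    𝟙 (outside124 (suc (suc k))) + outsideCount L l + δ
      ≡⟨ regroup (𝟙 (outside124 (suc (suc k)))) (outsideCount L l) δ ⟩
    outsideCount L l + (δ + 𝟙 (outside124 (suc (suc k))))
      ∎)
    where
    regroup : ∀ x c d → x + c + d ≡ c + (d + x)
    regroup = solve-∀

  cumCount-onesDominate-1 : ∀ L δ t → cumCount (onesDominate L δ) (δ + t) 1 ≤ cumPaddedParts 1 t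
  cumCount-onesDominate-1 L zero    t = ≤-trans (cumCount-mono (λ _ _ → tt) t 1) (≤-reflexive (cumCount-all 1 t))
  cumCount-onesDominate-1 L (suc d) t = begin
    cumCount (onesDominate L (suc d)) (suc d + t) 1
      ≡⟨ cumCount-≥ _ (suc d + t) 0 (s≤s z≤n) ⟩
    cumCount (onesDominate L (suc d)) (suc d + t) 0 + cumCount (λ l → onesDominate L (suc d) (1 ∷ l)) (d + t) 1
      ≡⟨ cong₂ _+_ (cumCount-[] _ (suc d + t)) (cumCount-cong drop-1 (d + t) 1) ⟩
    cumCount (onesDominate L d) (d + t) 1
      ≤⟨ cumCount-onesDominate-1 L d t ⟩
    cumPaddedParts 1 t
      ∎
    where
    drop-1 : ∀ l → onesDominate L (suc d) (1 ∷ l) ≡ onesDominate L d l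
    drop-1 l = trans (cong (_≤ᵇ suc (vCount l)) (+-suc (outsideCount L l) d)) (suc-≤ᵇ-suc (outsideCount L l + d) (vCount l))

  cumCount-onesDominate-step : ∀ L k → suc (suc k) ≤ L →
    (∀ δ t → cumCount (onesDominate L δ) (δ + t) (suc k) ≤ cumPaddedParts (suc k) t) →
    ∀ δ t → cumCount (onesDominate L δ) (δ + t) (suc (suc k)) ≤ cumPaddedParts (suc (suc k)) t
  cumCount-onesDominate-step L k k+2≤L below δ t = <-rec P go t δ
    where
    m = suc k
    x = 𝟙 (outside124 (suc m))
    P : ℕ → Set
    P t = ∀ δ → cumCount (onesDominate L δ) (δ + t) (suc m) ≤ cumPaddedParts (suc m) t
    shift : ∀ {δ t} → suc (m + x) ≤ t → δ + t ∸ suc m ≡ δ + x + (t ∸ suc (m + x))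
    shift {δ} {t} m+x<t with m≤n⇒∃[o]m+o≡n m+x<t
    ... | o , refl = begin-equality
      δ + (suc (m + x) + o) ∸ suc m           ≡⟨ cong (_∸ suc m) (regroup δ x m o) ⟩
      suc m + (δ + x + o) ∸ suc m             ≡⟨ m+n∸m≡n (suc m) (δ + x + o) ⟩
      δ + x + o                               ≡⟨ cong (δ + x +_) (m+n∸m≡n (suc (m + x)) o) ⟨
      δ + x + (suc (m + x) + o ∸ suc (m + x)) ∎
      where
      regroup : ∀ δ x m o → δ + (suc (m + x) + o) ≡ suc m + (δ + x + o)
      regroup = solve-∀
    too-small : ∀ {δ t} → t < suc (m + x) → suc m ≤ δ + t → δ + t ∸ suc m < δ + x
    too-small {δ} {t} t≤m+x m<δ+t = begin-strict
      δ + t ∸ suc m           <⟨ ∸-monoˡ-< (+-monoʳ-< δ t≤m+x) m<δ+t ⟩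
      δ + suc (m + x) ∸ suc m ≡⟨ cong (_∸ suc m) (regroup δ x m) ⟩
      δ + x + suc m ∸ suc m   ≡⟨ m+n∸n≡m (δ + x) (suc m) ⟩
      δ + x                   ∎
      where
      regroup : ∀ δ x m → δ + suc (m + x) ≡ δ + x + suc m
      regroup = solve-∀
    go : ∀ t → (∀ {u} → u < t → P u) → P t
    go t ih δ with ≤-<-connex (suc m) (δ + t)
    ... | inj₂ δ+t≤m = begin
      cumCount (onesDominate L δ) (δ + t) (suc m) ≡⟨ cumCount-< _ (δ + t) m (≤-pred δ+t≤m) ⟩
      cumCount (onesDominate L δ) (δ + t) m       ≤⟨ below δ t ⟩
      cumPaddedParts m t                          ≤⟨ cumPaddedParts-monoˡ m t ⟩
      cumPaddedParts (suc m) t                    ∎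
    ... | inj₁ m<δ+t = begin
      cumCount (onesDominate L δ) (δ + t) (suc m)
        ≡⟨ cumCount-≥ _ (δ + t) m m<δ+t ⟩
      cumCount (onesDominate L δ) (δ + t) m + cumCount (λ l → onesDominate L δ (suc m ∷ l)) (δ + t ∸ suc m) (suc m)
        ≡⟨ cong (cumCount (onesDominate L δ) (δ + t) m +_) (cumCount-cong (λ l → onesDominate-∷ L δ k l k+2≤L) (δ + t ∸ suc m) (suc m)) ⟩
      cumCount (onesDominate L δ) (δ + t) m + cumCount (onesDominate L (δ + x)) (δ + t ∸ suc m) (suc m)
        ≤⟨ +-monoˡ-≤ _ (below δ t) ⟩
      cumPaddedParts m t + cumCount (onesDominate L (δ + x)) (δ + t ∸ suc m) (suc m)
        ≤⟨ with-part-suc-m ⟩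
      cumPaddedParts (suc m) t
        ∎
      where
      with-part-suc-m : cumPaddedParts m t + cumCount (onesDominate L (δ + x)) (δ + t ∸ suc m) (suc m) ≤ cumPaddedParts (suc m) t
      with-part-suc-m with ≤-<-connex (suc (m + x)) t
      ... | inj₁ m+x<t = begin
        cumPaddedParts m t + cumCount (onesDominate L (δ + x)) (δ + t ∸ suc m) (suc m)
          ≡⟨ cong (λ s → cumPaddedParts m t + cumCount (onesDominate L (δ + x)) s (suc m)) (shift {δ} m+x<t) ⟩
        cumPaddedParts m t + cumCount (onesDominate L (δ + x)) (δ + x + (t ∸ suc (m + x))) (suc m)
          ≤⟨ +-monoʳ-≤ (cumPaddedParts m t) (ih (m∸1+n<m (m + x) m+x<t) (δ + x)) ⟩
        cumPaddedParts m t + cumPaddedParts (suc m) (t ∸ suc (m + x))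
          ≡⟨ cong (cumPaddedParts m t +_) (cumPaddedParts-suc m (t ∸ suc (m + x))) ⟩
        cumPaddedParts m t + strideSum (suc (m + x)) (cumPaddedParts m) (t ∸ suc (m + x))
          ≡⟨ strideSum-≥ (m + x) (cumPaddedParts m) t m+x<t ⟨
        strideSum (suc (m + x)) (cumPaddedParts m) t
          ≡⟨ cumPaddedParts-suc m t ⟨
        cumPaddedParts (suc m) t
          ∎
      ... | inj₂ t≤m+x = begin
        cumPaddedParts m t + cumCount (onesDominate L (δ + x)) (δ + t ∸ suc m) (suc m)
          ≡⟨ cong (cumPaddedParts m t +_) (cumCount-≡0 _ (δ + t ∸ suc m) (suc m) (λ n n≤ →
               onesDominate-vanish L (suc m) n (δ + x) (≤-<-trans n≤ (too-small t≤m+x m<δ+t)))) ⟩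
        cumPaddedParts m t + 0   ≡⟨ +-identityʳ _ ⟩
        cumPaddedParts m t       ≤⟨ cumPaddedParts-monoˡ m t ⟩
        cumPaddedParts (suc m) t ∎

  cumCount-onesDominate≤ : ∀ L m → m ≤ L → ∀ δ t → cumCount (onesDominate L δ) (δ + t) m ≤ cumPaddedParts m t
  cumCount-onesDominate≤ L zero          _     δ t = ≤-trans (≤-reflexive (cumCount-[] _ (δ + t))) (𝟙≤1 _)
  cumCount-onesDominate≤ L (suc zero)    _       = cumCount-onesDominate-1 L
  cumCount-onesDominate≤ L (suc (suc k)) k+2≤L   =
    cumCount-onesDominate-step L k k+2≤L (cumCount-onesDominate≤ L (suc k) (≤-trans (n≤1+n (suc k)) k+2≤L))

  smallMass : ℕ → List ℕ → ℕ
  smallMass L []      = 0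
  smallMass L (k ∷ l) = (if k ≤ᵇ L then k else 0) + smallMass L l

  massive : ℕ → ℕ → List ℕ → Bool
  massive L r l = r ≤ᵇ smallMass L l

  massiveDominated : ℕ → ℕ → List ℕ → Bool
  massiveDominated L r l = massive L r l ∧ onesDominate L 0 l

  massive-vanish : ∀ L m n r → n < r → countParts (massive L r) n m ≡ 0
  massive-vanish L = countParts-vanish (massive L) (λ _ → refl) drop
    where
    drop : ∀ r k l → suc k < r → T (massive L r (suc k ∷ l)) → T (massive L (r ∸ suc k) l)
    drop r k l _ mass = ≤⇒≤ᵇ (begin
      r ∸ suc k                     ≤⟨ ∸-monoˡ-≤ (suc k) (≤-trans (≤ᵇ⇒≤ r _ mass) (+-monoˡ-≤ (smallMass L l) (if≤ (suc k ≤ᵇ L)))) ⟩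
      suc k + smallMass L l ∸ suc k ≡⟨ m+n∸m≡n (suc k) (smallMass L l) ⟩
      smallMass L l                 ∎)
      where
      if≤ : ∀ b → (if b then suc k else 0) ≤ suc k
      if≤ true  = ≤-refl
      if≤ false = z≤n

  massiveDominated-∷ : ∀ L r k l → 1 ≤ L → L < k → massiveDominated L r (k ∷ l) ≡ massiveDominated L r l
  massiveDominated-∷ L r (suc (suc k)) l _ L<k = cong₂ _∧_
    (cong (λ b → r ≤ᵇ (if b then suc (suc k) else 0) + smallMass L l) (≤ᵇ-false L<k))
    (cong (λ b → 𝟙 b + outsideCount L l + 0 ≤ᵇ vCount l) (trans (cong (outside124 (suc (suc k)) ∧_) (≤ᵇ-false L<k)) (∧-zeroʳ _)))
  massiveDominated-∷ (suc L) r (suc zero) l _ (s≤s ())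

  cumCount-massiveDominated≤-base : ∀ L s → 5 ≤ L →
    suc L * cumCount (massiveDominated L (paddedThreshold L)) s L ≤ 4 * cumParts L s
  cumCount-massiveDominated≤-base L s 5≤L with ≤-<-connex (paddedThreshold L) s
  ... | inj₁ threshold≤s = begin
    suc L * cumCount (massiveDominated L (paddedThreshold L)) s L ≤⟨ *-monoʳ-≤ (suc L) (cumCount-mono (λ _ md → proj₂ (Equivalence.to T-∧ md)) s L) ⟩
    suc L * cumCount (onesDominate L 0) s L                       ≤⟨ *-monoʳ-≤ (suc L) (cumCount-onesDominate≤ L L ≤-refl 0 s) ⟩
    suc L * cumPaddedParts L s                                    ≤⟨ cumPaddedParts-sparse L s 5≤L threshold≤s ⟩
    4 * cumParts L s                                              ∎
  ... | inj₂ s<threshold = begin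
    suc L * cumCount (massiveDominated L (paddedThreshold L)) s L
      ≤⟨ *-monoʳ-≤ (suc L) (cumCount-mono (λ _ md → proj₁ (Equivalence.to T-∧ md)) s L) ⟩
    suc L * cumCount (massive L (paddedThreshold L)) s L
      ≡⟨ cong (suc L *_) (cumCount-≡0 _ s L (λ n n≤s → massive-vanish L L n _ (≤-<-trans n≤s s<threshold))) ⟩
    suc L * 0
      ≡⟨ *-zeroʳ (suc L) ⟩
    0
      ≤⟨ z≤n ⟩
    4 * cumParts L s
      ∎

  -- Parts larger than L do not affect massiveDominated L, so the bound propagates through the recursion
  -- of cumParts.
  cumCount-massiveDominated≤ : ∀ L M s → 5 ≤ L → L ≤ M →
    suc L * cumCount (massiveDominated L (paddedThreshold L)) s M ≤ 4 * cumParts M s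
  cumCount-massiveDominated≤ L M s 5≤L L≤M = go (≤⇒≤′ L≤M) s
    where
    Q = massiveDominated L (paddedThreshold L)
    go : ∀ {M} → L ≤′ M → ∀ s → suc L * cumCount Q s M ≤ 4 * cumParts M s
    go ≤′-refl              s = cumCount-massiveDominated≤-base L s 5≤L
    go {suc M} (≤′-step L≤′M) = strideInduction M P base step
      where
      L<suc-M : L < suc M
      L<suc-M = s≤s (≤′⇒≤ L≤′M)
      P : ℕ → Set
      P s = suc L * cumCount Q s (suc M) ≤ 4 * cumParts (suc M) s
      base : ∀ s → s < suc M → P s
      base s s≤M = begin
        suc L * cumCount Q s (suc M) ≡⟨ cong (suc L *_) (cumCount-< Q s M (≤-pred s≤M)) ⟩
        suc L * cumCount Q s M       ≤⟨ go L≤′M s ⟩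
        4 * cumParts M s             ≤⟨ *-monoʳ-≤ 4 (f≤strideSum M (cumParts M) s) ⟩
        4 * cumParts (suc M) s       ∎
      step : ∀ s → suc M ≤ s → P (s ∸ suc M) → P s
      step s M<s ih = begin
        suc L * cumCount Q s (suc M)
          ≡⟨ cong (suc L *_) (trans (cumCount-≥ Q s M M<s) (cong (cumCount Q s M +_)
               (cumCount-cong (λ l → massiveDominated-∷ L (paddedThreshold L) (suc M) l (≤-trans (s≤s z≤n) 5≤L) L<suc-M) (s ∸ suc M) (suc M)))) ⟩
        suc L * (cumCount Q s M + cumCount Q (s ∸ suc M) (suc M))
          ≡⟨ *-distribˡ-+ (suc L) (cumCount Q s M) _ ⟩
        suc L * cumCount Q s M + suc L * cumCount Q (s ∸ suc M) (suc M)
          ≤⟨ +-mono-≤ (go L≤′M s) ih ⟩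
        4 * cumParts M s + 4 * cumParts (suc M) (s ∸ suc M)
          ≡⟨ *-distribˡ-+ 4 (cumParts M s) _ ⟨
        4 * (cumParts M s + cumParts (suc M) (s ∸ suc M))
          ≡⟨ cong (4 *_) (strideSum-≥ M (cumParts M) s M<s) ⟨
        4 * cumParts (suc M) s
          ∎

  -- Partitions with few parts

  short : ℕ → List ℕ → Bool
  short K l = length l ≤ᵇ K

  cumCount-short≤ : ∀ m K s → cumCount (short K) s m ≤ suc m ^ K
  cumCount-short≤ zero K s = begin
    cumCount (short K) s 0 ≡⟨ cumCount-[] (short K) s ⟩
    𝟙 (short K [])         ≤⟨ 𝟙≤1 _ ⟩
    1                      ≡⟨ ^-zeroˡ K ⟨
    1 ^ K                  ∎
  cumCount-short≤ (suc m) K s with ≤-<-connex (suc m) s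
  ... | inj₂ s≤m = begin
    cumCount (short K) s (suc m) ≡⟨ cumCount-< _ s m (≤-pred s≤m) ⟩
    cumCount (short K) s m       ≤⟨ cumCount-short≤ m K s ⟩
    suc m ^ K                    ≤⟨ ^-monoˡ-≤ K (n≤1+n (suc m)) ⟩
    suc (suc m) ^ K              ∎
  cumCount-short≤ (suc m) zero    s | inj₁ m<s = begin
    cumCount (short 0) s (suc m)
      ≡⟨ cumCount-≥ _ s m m<s ⟩
    cumCount (short 0) s m + cumCount (λ _ → false) (s ∸ suc m) (suc m)
      ≡⟨ cong (cumCount (short 0) s m +_) (cumCount-≡0 (λ _ → false) (s ∸ suc m) (suc m) (λ n _ → countᵇ-false (parts n (suc m)))) ⟩
    cumCount (short 0) s m + 0
      ≡⟨ +-identityʳ _ ⟩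
    cumCount (short 0) s m
      ≤⟨ cumCount-short≤ m 0 s ⟩
    1
      ∎
  cumCount-short≤ (suc m) (suc K) s | inj₁ m<s = begin
    cumCount (short (suc K)) s (suc m)
      ≡⟨ cumCount-≥ _ s m m<s ⟩
    cumCount (short (suc K)) s m + cumCount (λ l → short (suc K) (suc m ∷ l)) (s ∸ suc m) (suc m)
      ≡⟨ cong (cumCount (short (suc K)) s m +_) (cumCount-cong (λ l → suc-≤ᵇ-suc (length l) K) (s ∸ suc m) (suc m)) ⟩
    cumCount (short (suc K)) s m + cumCount (short K) (s ∸ suc m) (suc m)
      ≤⟨ +-mono-≤ (cumCount-short≤ m (suc K) s) (cumCount-short≤ (suc m) K (s ∸ suc m)) ⟩
    suc m * suc m ^ K + suc (suc m) ^ K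
      ≤⟨ +-monoˡ-≤ _ (*-monoʳ-≤ (suc m) (^-monoˡ-≤ K (n≤1+n (suc m)))) ⟩
    suc m * suc (suc m) ^ K + suc (suc m) ^ K
      ≡⟨ +-comm _ (suc (suc m) ^ K) ⟩
    suc (suc m) ^ suc K
      ∎

  cumParts-lower : ∀ m q s → m * m * q ≤ s → suc q ^ m ≤ cumParts m s
  cumParts-lower zero    q s _      = ≤-refl
  cumParts-lower (suc m) q s mmq≤s = begin
    suc q * suc q ^ m                  ≤⟨ *-monoʳ-≤ (suc q) (cumParts-lower m q (s ∸ suc m * q) mmq≤s-mq) ⟩
    suc q * cumParts m (s ∸ suc m * q) ≤⟨ *≤strideSum (cumParts-monotonic m) m q s mq≤s ⟩
    cumParts (suc m) s                 ∎
    where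
    regroup : ∀ m q → suc m * suc m * q ≡ m * m * q + suc m * q + m * q
    regroup = solve-∀
    mmq+mq≤s : m * m * q + suc m * q ≤ s
    mmq+mq≤s = ≤-trans (m≤m+n _ (m * q)) (≤-trans (≤-reflexive (sym (regroup m q))) mmq≤s)
    mq≤s : suc m * q ≤ s
    mq≤s = ≤-trans (m≤n+m _ (m * m * q)) mmq+mq≤s
    mmq≤s-mq : m * m * q ≤ s ∸ suc m * q
    mmq≤s-mq = ≤-trans (≤-reflexive (sym (m+n∸n≡m (m * m * q) (suc m * q)))) (∸-monoˡ-≤ (suc m * q) mmq+mq≤s)

  -- Non-admissible partitions

  in124 : ℕ → Bool
  in124 e = (e == 1) ∨ (e == 2) ∨ (e == 4)

  count124 : List ℕ → ℕ
  count124 = countᵇ in124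

  uPart wPart : ℕ → Bool
  uPart e = isEven e ∧ not (e == 2) ∧ not (e == 4)
  wPart e = not (isEven e) ∧ not (e == 1)

  length≡count124+u+w : ∀ l → length l ≡ count124 l + uCount l + wCount l
  length≡count124+u+w []      = refl
  length≡count124+u+w (e ∷ l) = begin-equality
    1 + length l
      ≡⟨ cong₂ _+_ (one-class e) (sym (length≡count124+u+w l)) ⟨
    𝟙 (in124 e) + 𝟙 (uPart e) + 𝟙 (wPart e) + (count124 l + uCount l + wCount l)
      ≡⟨ regroup (𝟙 (in124 e)) (𝟙 (uPart e)) (𝟙 (wPart e)) (count124 l) (uCount l) (wCount l) ⟩
    𝟙 (in124 e) + count124 l + (𝟙 (uPart e) + uCount l) + (𝟙 (wPart e) + wCount l)
      ∎
    where
    regroup : ∀ a b c x y z → a + b + c + (x + y + z) ≡ a + x + (b + y) + (c + z)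
    regroup = solve-∀
    one-class : ∀ e → 𝟙 (in124 e) + 𝟙 (uPart e) + 𝟙 (wPart e) ≡ 1
    one-class 0 = refl
    one-class 1 = refl
    one-class 2 = refl
    one-class 3 = refl
    one-class 4 = refl
    one-class (suc (suc (suc (suc (suc n))))) with isEven (suc n)
    ... | true  = refl
    ... | false = refl

  outsideCount≤u+w : ∀ L l → outsideCount L l ≤ uCount l + wCount l
  outsideCount≤u+w L []      = z≤n
  outsideCount≤u+w L (e ∷ l) = begin
    𝟙 (outside124 e ∧ (e ≤ᵇ L)) + outsideCount L l    ≤⟨ +-mono-≤ (outside≤u+w e) (outsideCount≤u+w L l) ⟩
    𝟙 (uPart e) + 𝟙 (wPart e) + (uCount l + wCount l) ≡⟨ +-interchange (𝟙 (uPart e)) (𝟙 (wPart e)) (uCount l) (wCount l) ⟩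
    𝟙 (uPart e) + uCount l + (𝟙 (wPart e) + wCount l) ∎
    where
    outside≤u+w : ∀ e → 𝟙 (outside124 e ∧ (e ≤ᵇ L)) ≤ 𝟙 (uPart e) + 𝟙 (wPart e)
    outside≤u+w 0 = z≤n
    outside≤u+w 1 = z≤n
    outside≤u+w 2 = z≤n
    outside≤u+w 3 = 𝟙≤1 (3 ≤ᵇ L)
    outside≤u+w 4 = z≤n
    outside≤u+w (suc (suc (suc (suc (suc n))))) with isEven (suc n)
    ... | true  = 𝟙≤1 _
    ... | false = 𝟙≤1 _

  count124≤smallMass : ∀ L l → 4 ≤ L → count124 l ≤ smallMass L l
  count124≤smallMass L []      _   = z≤n
  count124≤smallMass L (e ∷ l) 4≤L = +-mono-≤ (in124≤ e) (count124≤smallMass L l 4≤L)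
    where
    in124≤ : ∀ e → 𝟙 (in124 e) ≤ (if e ≤ᵇ L then e else 0)
    in124≤ 0 = z≤n
    in124≤ 1 rewrite ≤ᵇ-true {1} {L} (≤-trans (s≤s z≤n) 4≤L) = ≤-refl
    in124≤ 2 rewrite ≤ᵇ-true {2} {L} (≤-trans (s≤s (s≤s z≤n)) 4≤L) = s≤s z≤n
    in124≤ 3 = z≤n
    in124≤ 4 rewrite ≤ᵇ-true {4} {L} 4≤L = s≤s z≤n
    in124≤ (suc (suc (suc (suc (suc n))))) = z≤n

  vCount≤count124 : ∀ l → vCount l ≤ count124 l
  vCount≤count124 []      = z≤n
  vCount≤count124 (e ∷ l) = +-mono-≤ (one≤in124 e) (vCount≤count124 l)
    where
    one≤in124 : ∀ e → 𝟙 (e == 1) ≤ 𝟙 (in124 e)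
    one≤in124 1 = ≤-refl
    one≤in124 0 = z≤n
    one≤in124 (suc (suc n)) = z≤n

  nonadmissible⇒u+w≤v : ∀ l → admissible l ≡ false → uCount l + wCount l ≤ vCount l
  nonadmissible⇒u+w≤v l not-admissible = ≤-trans (+-monoˡ-≤ W U≤1+2⌊U/2⌋) 1+2⌊U/2⌋+W≤V
    where
    U = uCount l
    W = wCount l
    1+2⌊U/2⌋+W≤V : suc (2 * (U / 2) + W) ≤ vCount l
    1+2⌊U/2⌋+W≤V = ≰⇒> (λ V≤ → subst T not-admissible (≤⇒≤ᵇ V≤))
    U≤1+2⌊U/2⌋ : U ≤ suc (2 * (U / 2))
    U≤1+2⌊U/2⌋ = begin
      U                 ≡⟨ m≡m%n+[m/n]*n U 2 ⟩
      U % 2 + U / 2 * 2 ≤⟨ +-monoˡ-≤ _ (≤-pred (m%n<n U 2)) ⟩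
      1 + U / 2 * 2     ≡⟨ cong suc (*-comm (U / 2) 2) ⟩
      suc (2 * (U / 2)) ∎

  nonadmissible⇒massiveDominated∨short : ∀ L r l → 4 ≤ L → admissible l ≡ false →
                                          T (massiveDominated L r l ∨ short (r + r) l)
  nonadmissible⇒massiveDominated∨short L r l 4≤L not-admissible with ≤-<-connex r (smallMass L l)
  ... | inj₁ r≤mass = Equivalence.from T-∨ (inj₁ (Equivalence.from T-∧ (≤⇒≤ᵇ r≤mass , ≤⇒≤ᵇ (begin
      outsideCount L l + 0     ≡⟨ +-identityʳ _ ⟩
      outsideCount L l         ≤⟨ outsideCount≤u+w L l ⟩
      uCount l + wCount l      ≤⟨ nonadmissible⇒u+w≤v l not-admissible ⟩
      vCount l                 ∎))))
  ... | inj₂ mass<r = Equivalence.from T-∨ (inj₂ (≤⇒≤ᵇ (begin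
      length l                     ≡⟨ length≡count124+u+w l ⟩
      C + uCount l + wCount l      ≡⟨ +-assoc C (uCount l) (wCount l) ⟩
      C + (uCount l + wCount l)    ≤⟨ +-monoʳ-≤ C (≤-trans (nonadmissible⇒u+w≤v l not-admissible) (vCount≤count124 l)) ⟩
      C + C                        ≤⟨ +-mono-≤ C≤r C≤r ⟩
      r + r                        ∎)))
    where
    C = count124 l
    C≤r : C ≤ r
    C≤r = ≤-trans (count124≤smallMass L l 4≤L) (<⇒≤ mass<r)

  nonadmissible : List ℕ → Bool
  nonadmissible l = not (admissible l)

  totalCount admissibleCount nonadmissibleCount : ℕ → ℕ
  totalCount         = sumFrom1 (λ i → length (𝒢 i))
  admissibleCount    = sumFrom1 (λ i → length (𝒜 i))
  nonadmissibleCount = sumFrom1 (λ i → countParts nonadmissible i i)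

  totalCount≡admissible+nonadmissible : ∀ n → totalCount n ≡ admissibleCount n + nonadmissibleCount n
  totalCount≡admissible+nonadmissible n = trans (sumFrom1-cong n (λ i _ → split i)) (sumFrom1-+ _ _ n)
    where
    split : ∀ i → length (𝒢 i) ≡ length (𝒜 i) + countParts nonadmissible i i
    split i = trans (sym (countᵇ+countᵇ-not≡length admissible (parts i i)))
                    (cong (_+ countParts nonadmissible i i) (sym (length-filterᵇ admissible (parts i i))))

  cumParts≡1+totalCount : ∀ n → cumParts n n ≡ suc (totalCount n)
  cumParts≡1+totalCount n = begin-equality
    cumParts n n                                             ≡⟨ cumCount-all n n ⟨
    prefixSum (λ i → countParts (λ _ → true) i n) n          ≡⟨ prefixSum≡sumFrom1 _ n ⟩
    1 + sumFrom1 (λ i → countParts (λ _ → true) i n) n       ≡⟨ cong suc (sumFrom1-cong n (λ i i≤n →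
                                                                  trans (cong (countᵇ _) (parts-bound≥size i n i≤n)) (countᵇ-true (parts i i)))) ⟩
    suc (totalCount n)                                       ∎

  cumCount-nonadmissible : ∀ n → cumCount nonadmissible n n ≡ nonadmissibleCount n
  cumCount-nonadmissible n = trans (prefixSum≡sumFrom1 _ n)
    (sumFrom1-cong n (λ i i≤n → cong (countᵇ nonadmissible) (parts-bound≥size i n i≤n)))

  -- L makes massive dominated partitions a 4/(L+1)-fraction of all, K bounds the length of the others,
  -- and beyond n₀ the superpolynomial cumParts n n outgrows (L+1)(n+1)^K.
  module Thresholds (N : ℕ) where
    L K D C Q₀ n₀ : ℕ
    L  = 16 * N + 5
    K  = paddedThreshold L + paddedThreshold L
    D  = suc K
    C  = D * D
    Q₀ = suc L * C ^ K
    n₀ = C * Q₀ + D + L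

    nonadmissibleCount-bound : ∀ n → L ≤ n → suc L * nonadmissibleCount n ≤ 4 * cumParts n n + suc L * suc n ^ K
    nonadmissibleCount-bound n L≤n = begin
      suc L * nonadmissibleCount n                              ≡⟨ cong (suc L *_) (cumCount-nonadmissible n) ⟨
      suc L * cumCount nonadmissible n n                        ≤⟨ *-monoʳ-≤ (suc L) (cumCount-mono classify n n) ⟩
      suc L * cumCount (λ l → Q l ∨ short K l) n n              ≤⟨ *-monoʳ-≤ (suc L) (cumCount-∨ Q (short K) n n) ⟩
      suc L * (cumCount Q n n + cumCount (short K) n n)         ≡⟨ *-distribˡ-+ (suc L) (cumCount Q n n) _ ⟩
      suc L * cumCount Q n n + suc L * cumCount (short K) n n   ≤⟨ +-mono-≤ (cumCount-massiveDominated≤ L n n 5≤L L≤n)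
                                                                           (*-monoʳ-≤ (suc L) (cumCount-short≤ n K n)) ⟩
      4 * cumParts n n + suc L * suc n ^ K                      ∎
      where
      Q = massiveDominated L (paddedThreshold L)
      5≤L : 5 ≤ L
      5≤L = m≤n+m 5 (16 * N)
      classify : ∀ l → T (nonadmissible l) → T (Q l ∨ short K l)
      classify l na = nonadmissible⇒massiveDominated∨short L (paddedThreshold L) l (≤-trans (n≤1+n 4) 5≤L) (Equivalence.to T-not-≡ na)

    cumParts-large : ∀ n → n₀ ≤ n → suc L * suc n ^ K < cumParts n n
    cumParts-large n n₀≤n = begin-strict
      suc L * suc n ^ K        ≤⟨ *-monoʳ-≤ (suc L) (^-monoˡ-≤ K n<C[q+1]) ⟩
      suc L * (C * suc q) ^ K  ≡⟨ cong (suc L *_) (^-distribʳ-* C (suc q) K) ⟩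
      suc L * (C ^ K * X)      ≡⟨ *-assoc (suc L) (C ^ K) X ⟨
      Q₀ * X                   <⟨ *-monoˡ-< X (s≤s Q₀≤q) ⟩
      suc q * X                ≤⟨ cumParts-lower D q n DDq≤n ⟩
      cumParts D n             ≤⟨ cumParts-monoˡ n D≤n ⟩
      cumParts n n             ∎
      where
      q = n / C
      X = suc q ^ K
      instance
        X-nonZero : NonZero X
        X-nonZero = m^n≢0 (suc q) K
      D≤n : D ≤ n
      D≤n = ≤-trans (≤-trans (m≤n+m D (C * Q₀)) (m≤m+n (C * Q₀ + D) L)) n₀≤n
      DDq≤n : D * D * q ≤ n
      DDq≤n = ≤-trans (≤-reflexive (*-comm C q)) (m/n*n≤m n C)
      n<C[q+1] : suc n ≤ C * suc q
      n<C[q+1] = begin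
        suc n               ≡⟨ cong suc (m≡m%n+[m/n]*n n C) ⟩
        suc (n % C + q * C) ≤⟨ +-monoˡ-≤ (q * C) (m%n<n n C) ⟩
        C + q * C           ≡⟨ trans (cong (C +_) (*-comm q C)) (sym (*-suc C q)) ⟩
        C * suc q           ∎
      Q₀≤q : Q₀ ≤ q
      Q₀≤q = begin
        Q₀         ≡⟨ m*n/n≡m Q₀ C ⟨
        Q₀ * C / C ≤⟨ /-monoˡ-≤ C (≤-trans (≤-reflexive (*-comm Q₀ C)) (≤-trans (m≤m+n (C * Q₀) D) (≤-trans (m≤m+n (C * Q₀ + D) L) n₀≤n))) ⟩
        q          ∎

    N*nonadmissible<total : ∀ n → n₀ ≤ n → N * nonadmissibleCount n < totalCount n
    N*nonadmissible<total n n₀≤n = *-cancelˡ-< 16 _ _ (begin-strict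
      16 * (N * b)        ≡⟨ *-assoc 16 N b ⟨
      16 * N * b          ≤⟨ *-monoˡ-≤ b (m≤m+n (16 * N) 6) ⟩
      (16 * N + 6) * b    ≡⟨ cong (_* b) (+-suc (16 * N) 5) ⟩
      suc L * b           ≤⟨ nonadmissibleCount-bound n L≤n ⟩
      4 * a + x           ≤⟨ +-monoʳ-≤ (4 * a) (<⇒≤ x<a) ⟩
      4 * a + a           ≡⟨ cong (λ y → 4 * y + y) a≡1+g ⟩
      4 * suc g + suc g   <⟨ 5[1+g]<16g 1≤g ⟩
      16 * g              ∎)
      where
      a = cumParts n n
      b = nonadmissibleCount n
      g = totalCount n
      x = suc L * suc n ^ K
      x<a : x < a
      x<a = cumParts-large n n₀≤n
      a≡1+g : a ≡ suc g
      a≡1+g = cumParts≡1+totalCount n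
      L≤n : L ≤ n
      L≤n = ≤-trans (m≤n+m L (C * Q₀ + D)) n₀≤n
      1≤g : 1 ≤ g
      1≤g = ≤-pred (≤-trans (s≤s (*-mono-≤ (s≤s (z≤n {L})) (m^n>0 (suc n) K))) (≤-trans x<a (≤-reflexive a≡1+g)))
      5[1+g]<16g : ∀ {g} → 1 ≤ g → 4 * suc g + suc g < 16 * g
      5[1+g]<16g {suc g} _ = ≤-trans (m≤m+n _ (11 * g + 5)) (≤-reflexive (regroup g))
        where
        regroup : ∀ g → suc (4 * suc (suc g) + suc (suc g)) + (11 * g + 5) ≡ 16 * suc g
        regroup = solve-∀

open Counting using (totalCount; admissibleCount; nonadmissibleCount; totalCount≡admissible+nonadmissible; module Thresholds)
open import Data.Integer as ℤ using (+_; +[1+_]; -[1+_])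
import Data.Integer.Properties as ℤ
open import Data.Integer.Tactic.RingSolver using (solve-∀)
open import Data.Nat as ℕ using (ℕ; suc; _≤_)
import Data.Nat.Properties as ℕ
open import Data.Product using (_,_; ∃-syntax)
open import Data.Rational using (ℚ; mkℚ; 0ℚ; 1ℚ; _<_; _-_; ∣_∣; toℚᵘ; fromℚᵘ; positive)
import Data.Rational as ℚ
open import Data.Rational.Properties using (toℚᵘ-homo-∣-∣; toℚᵘ-homo-+; toℚᵘ-homo‿-; toℚᵘ-fromℚᵘ; toℚᵘ-cancel-<)
import Data.Rational.Unnormalised as ℚᵘ
import Data.Rational.Unnormalised.Properties as ℚᵘ
open import Relation.Binary.PropositionalEquality using (_≡_; sym; trans; cong; subst; subst₂)

-- the numerator that ℚᵘ computes for a/(1+d) - 1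
∣a-[a+b]∣≡b : ∀ a b d → a ℕ.+ b ≡ suc d → ℤ.∣ + a ℤ.* + 1 ℤ.+ -[1+ 0 ] ℤ.* + suc d ∣ ≡ b
∣a-[a+b]∣≡b a b d a+b≡1+d = trans (cong ℤ.∣_∣ a-[a+b]≡-b) (ℤ.∣-i∣≡∣i∣ (+ b))
  where
  regroup : ∀ x y → x ℤ.* + 1 ℤ.+ ℤ.- + 1 ℤ.* (x ℤ.+ y) ≡ ℤ.- y
  regroup = solve-∀
  a-[a+b]≡-b : + a ℤ.* + 1 ℤ.+ -[1+ 0 ] ℤ.* + suc d ≡ ℤ.- (+ b)
  a-[a+b]≡-b = trans (cong (λ x → + a ℤ.* + 1 ℤ.+ -[1+ 0 ] ℤ.* x) (trans (cong +_ (sym a+b≡1+d)) (ℤ.pos-+ a b))) (regroup (+ a) (+ b))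

-- |a/(a+b) - 1| = b/(a+b) < 1/(denominator of ε) ≤ ε
∣a/[a+b]-1∣<ε : ∀ a b d ε → 0ℚ < ε → a ℕ.+ b ≡ suc d → ℚ.denominatorℕ ε ℕ.* b ℕ.< suc d →
                ∣ (+ a) ℚ./ suc d - 1ℚ ∣ < ε
∣a/[a+b]-1∣<ε a b d (mkℚ (+ 0)    _ _) 0<ε _ _ with () ← positive 0<ε
∣a/[a+b]-1∣<ε a b d (mkℚ -[1+ _ ] _ _) 0<ε _ _ with () ← positive 0<ε
∣a/[a+b]-1∣<ε a b d (mkℚ +[1+ n ] e _) _ a+b≡1+d εb<1+d = toℚᵘ-cancel-< (ℚᵘ.<-respˡ-≃ (ℚᵘ.≃-sym to-ℚᵘ) (ℚᵘ.*<* cross))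
  where
  x = ℚᵘ.mkℚᵘ (+ a) d
  to-ℚᵘ : toℚᵘ ∣ fromℚᵘ x - 1ℚ ∣ ℚᵘ.≃ ℚᵘ.∣ x ℚᵘ.+ ℚᵘ.- toℚᵘ 1ℚ ∣
  to-ℚᵘ = ℚᵘ.≃-trans (toℚᵘ-homo-∣-∣ (fromℚᵘ x - 1ℚ)) (ℚᵘ.∣-∣-cong (ℚᵘ.≃-trans (toℚᵘ-homo-+ (fromℚᵘ x) (ℚ.- 1ℚ))
                                                                 (ℚᵘ.+-cong (toℚᵘ-fromℚᵘ x) (toℚᵘ-homo‿- 1ℚ))))
  b[1+e]<[1+n][1+d] : b ℕ.* suc e ℕ.< suc n ℕ.* suc (d ℕ.* 1)
  b[1+e]<[1+n][1+d] = ℕ.<-≤-trans (subst (ℕ._< suc d) (ℕ.*-comm (suc e) b) εb<1+d)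
                                   (subst (suc d ℕ.≤_) (cong (λ k → suc n ℕ.* suc k) (sym (ℕ.*-identityʳ d))) (ℕ.m≤n*m (suc d) (suc n)))
  cross : + ℤ.∣ + a ℤ.* + 1 ℤ.+ -[1+ 0 ] ℤ.* + suc d ∣ ℤ.* + suc e ℤ.< +[1+ n ] ℤ.* + suc (d ℕ.* 1)
  cross rewrite ∣a-[a+b]∣≡b a b d a+b≡1+d =
    subst₂ ℤ._<_ (ℤ.pos-* b (suc e)) (ℤ.pos-* (suc n) (suc (d ℕ.* 1))) (ℤ.+<+ b[1+e]<[1+n][1+d])

ratio-close-to-1 : ∀ ε → 0ℚ < ε → ∀ n → ℚ.denominatorℕ ε ℕ.* nonadmissibleCount n ℕ.< totalCount n → ∣ ratio n - 1ℚ ∣ < ε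
ratio-close-to-1 ε 0<ε n εb<total with totalCount n in total≡
... | suc d = ∣a/[a+b]-1∣<ε (admissibleCount n) (nonadmissibleCount n) d ε 0<ε
                            (trans (sym (totalCount≡admissible+nonadmissible n)) total≡) εb<total

proposition2p5 : ∀ (ε : ℚ) → 0ℚ < ε →
    ∃[ N ] ∀ (n : ℕ) → N ≤ n → ∣ ratio n - 1ℚ ∣ < ε
proposition2p5 ε 0<ε = n₀ , λ n n₀≤n → ratio-close-to-1 ε 0<ε n (N*nonadmissible<total n n₀≤n)
  where open Thresholds (ℚ.denominatorℕ ε)
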